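{- In each of the bisequent calculi $\mathsf{BSC}(\mathbf K_3)$ and $\mathsf{BSC}(\mathbf K_3^w)$ described below, the following transfer rules are height-preserving admissible, for any formula $\varphi$: $(LTr)$: from $\Gamma\Rightarrow\Delta\mid\varphi,\Pi\Rightarrow\Sigma$ infer $\varphi,\Gamma\Rightarrow\Delta\mid\Pi\Rightarrow\Sigma$; $(RTr)$: from $\Gamma\Rightarrow\Delta,\varphi\mid\Pi\Rightarrow\Sigma$ infer $\Gamma\Rightarrow\Delta\mid\Pi\Rightarrow\Sigma,\varphi$. That is, if the premiss is derivable with a derivation of height at most $n$, so is the conclusion.
   Context: Language: parameters $a,b,c,\dots$; bound variables; predicate symbols including unary $E$ and binary $=$; $\neg,\rightarrow,\wedge,\forall$; $\imath$: if $\varphi$ contains no definite description, $\imath x\varphi$ is a term. Bisequents $\Gamma\Rightarrow\Delta\mid\Pi\Rightarrow\Sigma$ are pairs of sequents of finite multisets; height of a derivation is the length of its longest branch. Calculus ($S$ an arbitrary sequent). Axioms: some atomic formula (incl. identities and $Et$) in $\Gamma\cap\Sigma$, $\Gamma\cap\Delta$ or $\Pi\cap\Sigma$; and $Et_1..Et_n,\Gamma\Rightarrow\Delta,P(t_1..t_n)\mid P(t_1..t_n),\Pi\Rightarrow\Sigma$. Propositional rules of $\mathsf{BSC}(\mathbf K_3)$ (premisses / conclusion): $\Gamma\Rightarrow\Delta\mid\Pi\Rightarrow\Sigma,\varphi$ / $\neg\varphi,\Gamma\Rightarrow\Delta\mid\Pi\Rightarrow\Sigma$; $\Gamma\Rightarrow\Delta\mid\varphi,\Pi\Rightarrow\Sigma$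 / $\Gamma\Rightarrow\Delta,\neg\varphi\mid\Pi\Rightarrow\Sigma$; $\Gamma\Rightarrow\Delta,\varphi\mid\Pi\Rightarrow\Sigma$ / $\Gamma\Rightarrow\Delta\mid\neg\varphi,\Pi\Rightarrow\Sigma$; $\varphi,\Gamma\Rightarrow\Delta\mid\Pi\Rightarrow\Sigma$ / $\Gamma\Rightarrow\Delta\mid\Pi\Rightarrow\Sigma,\neg\varphi$; $\varphi,\psi,\Gamma\Rightarrow\Delta\mid S$ / $\varphi\wedge\psi,\Gamma\Rightarrow\Delta\mid S$; $\Gamma\Rightarrow\Delta,\varphi\mid S$ and $\Gamma\Rightarrow\Delta,\psi\mid S$ / $\Gamma\Rightarrow\Delta,\varphi\wedge\psi\mid S$; $S\mid\varphi,\psi,\Pi\Rightarrow\Sigma$ / $S\mid\varphi\wedge\psi,\Pi\Rightarrow\Sigma$; $S\mid\Pi\Rightarrow\Sigma,\varphi$ and $S\mid\Pi\Rightarrow\Sigma,\psi$ / $S\mid\Pi\Rightarrow\Sigma,\varphi\wedge\psi$; $\Gamma\Rightarrow\Delta,\psi\mid\varphi,\Pi\Rightarrow\Sigma$ / $\Gamma\Rightarrow\Delta,\varphi\rightarrow\psi\mid\Pi\Rightarrow\Sigma$; $\varphi,\Gamma\Rightarrow\Delta\mid\Pi\Rightarrow\Sigma,\psi$ / $\Gamma\Rightarrow\Delta\mid\Pi\Rightarrow\Sigma,\varphi\rightarrow\psi$; $\Gamma\Rightarrow\Delta\mid\Pi\Rightarrow\Sigma,\varphi$ and $\psi,\Gamma\Rightarrow\Delta\mid\Pi\Rightarrow\Sigma$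 / $\varphi\rightarrow\psi,\Gamma\Rightarrow\Delta\mid\Pi\Rightarrow\Sigma$; $\Gamma\Rightarrow\Delta,\varphi\mid\Pi\Rightarrow\Sigma$ and $\Gamma\Rightarrow\Delta\mid\psi,\Pi\Rightarrow\Sigma$ / $\Gamma\Rightarrow\Delta\mid\varphi\rightarrow\psi,\Pi\Rightarrow\Sigma$. In $\mathsf{BSC}(\mathbf K_3^w)$ four of these are replaced: $\Gamma\Rightarrow\Delta\mid\varphi,\psi,\Pi\Rightarrow\Sigma$; $\Gamma\Rightarrow\Delta,\varphi\mid\varphi,\Pi\Rightarrow\Sigma$; $\Gamma\Rightarrow\Delta,\psi\mid\psi,\Pi\Rightarrow\Sigma$ / $\Gamma\Rightarrow\Delta\mid\varphi\wedge\psi,\Pi\Rightarrow\Sigma$; $\Gamma\Rightarrow\Delta\mid\Pi\Rightarrow\Sigma,\varphi,\psi$; $\varphi,\Gamma\Rightarrow\Delta\mid\Pi\Rightarrow\Sigma,\psi$; $\psi,\Gamma\Rightarrow\Delta\mid\Pi\Rightarrow\Sigma,\varphi$ / $\Gamma\Rightarrow\Delta\mid\Pi\Rightarrow\Sigma,\varphi\wedge\psi$; $\Gamma\Rightarrow\Delta,\psi\mid\varphi,\Pi\Rightarrow\Sigma$; $\Gamma\Rightarrow\Delta,\varphi\mid\varphi,\Pi\Rightarrow\Sigma$; $\Gamma\Rightarrow\Delta,\psi\mid\psi,\Pi\Rightarrow\Sigma$ / $\Gamma\Rightarrow\Delta,\varphi\rightarrow\psi\mid\Pi\Rightarrow\Sigma$;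 $\varphi,\psi,\Gamma\Rightarrow\Delta\mid\Pi\Rightarrow\Sigma$; $\Gamma\Rightarrow\Delta\mid\Pi\Rightarrow\Sigma,\varphi,\psi$; $\psi,\Gamma\Rightarrow\Delta\mid\Pi\Rightarrow\Sigma,\varphi$ / $\varphi\rightarrow\psi,\Gamma\Rightarrow\Delta\mid\Pi\Rightarrow\Sigma$. Common rules. Quantifiers ($a$ fresh, $b$ arbitrary parameter): $Ea,\Gamma\Rightarrow\Delta,\varphi[x/a]\mid S$ / $\Gamma\Rightarrow\Delta,\forall x\varphi\mid S$; $Ea,\Gamma\Rightarrow\Delta\mid\Pi\Rightarrow\Sigma,\varphi[x/a]$ / $\Gamma\Rightarrow\Delta\mid\Pi\Rightarrow\Sigma,\forall x\varphi$; $Eb,\forall x\varphi,\varphi[x/b],\Gamma\Rightarrow\Delta\mid S$ / $Eb,\forall x\varphi,\Gamma\Rightarrow\Delta\mid S$; $Eb,\Gamma\Rightarrow\Delta\mid\forall x\varphi,\varphi[x/b],\Pi\Rightarrow\Sigma$ / $Eb,\Gamma\Rightarrow\Delta\mid\forall x\varphi,\Pi\Rightarrow\Sigma$. Existence ($P[t]$, $P(t_1..t_n)$ atoms or identities, not $Et$ and not identities between a parameter and a description; $P[t]$ contains $t$, $P(t_1..t_n)$ exactly the $t_i$): $Et,P[t],\Gamma\Rightarrow\Delta\mid S$ / $P[t],\Gamma\Rightarrow\Delta\mid S$; $Et,\Gamma\Rightarrow\Delta\mid\Pi\Rightarrow\Sigma,P[t]$ / $\Gamma\Rightarrow\Delta\mid\Pi\Rightarrow\Sigma,P[t]$;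 $Et_1..Et_n,P(t_1..t_n),\Gamma\Rightarrow\Delta\mid\Pi\Rightarrow\Sigma$ / $Et_1..Et_n,\Gamma\Rightarrow\Delta\mid P(t_1..t_n),\Pi\Rightarrow\Sigma$; $Et_1..Et_n,\Gamma\Rightarrow\Delta\mid\Pi\Rightarrow\Sigma,P(t_1..t_n)$ / $Et_1..Et_n,\Gamma\Rightarrow\Delta,P(t_1..t_n)\mid\Pi\Rightarrow\Sigma$; $Et,\Gamma\Rightarrow\Delta\mid\Pi\Rightarrow\Sigma$ / $\Gamma\Rightarrow\Delta\mid Et,\Pi\Rightarrow\Sigma$; $\Gamma\Rightarrow\Delta\mid\Pi\Rightarrow\Sigma,Et$ / $\Gamma\Rightarrow\Delta,Et\mid\Pi\Rightarrow\Sigma$. Identity ($A[x/t]$ atom, identity or $Et$; $t\approx s$ is $t=s$ or $s=t$; $a$ fresh; $d$ a description): $\Gamma\Rightarrow\Delta\mid\Pi\Rightarrow\Sigma,t\approx s$; $\Gamma\Rightarrow\Delta\mid\Pi\Rightarrow\Sigma,A[x/t]$; $A[x/s],\Gamma\Rightarrow\Delta\mid\Pi\Rightarrow\Sigma$ / $\Gamma\Rightarrow\Delta\mid\Pi\Rightarrow\Sigma$; $t=t,Et,\Gamma\Rightarrow\Delta\mid\Pi\Rightarrow\Sigma$ / $Et,\Gamma\Rightarrow\Delta\mid\Pi\Rightarrow\Sigma$; $a=d,Ed,\Gamma\Rightarrow\Delta\mid\Pi\Rightarrow\Sigma$ / $Ed,\Gamma\Rightarrow\Delta\mid\Pi\Rightarrow\Sigma$.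 Descriptions ($a$ fresh): $\varphi[x/c],c=\imath x\varphi,Ec,\Gamma\Rightarrow\Delta\mid S$ / $c=\imath x\varphi,Ec,\Gamma\Rightarrow\Delta\mid S$; $Ec,\Gamma\Rightarrow\Delta\mid\varphi[x/c],c=\imath x\varphi,\Pi\Rightarrow\Sigma$ / $Ec,\Gamma\Rightarrow\Delta\mid c=\imath x\varphi,\Pi\Rightarrow\Sigma$; $c=\imath x\varphi,Eb,Ec,\Gamma\Rightarrow\Delta\mid\Pi\Rightarrow\Sigma,\varphi[x/b]$ and $b=c,c=\imath x\varphi,Eb,Ec,\Gamma\Rightarrow\Delta\mid\Pi\Rightarrow\Sigma$ / $c=\imath x\varphi,Eb,Ec,\Gamma\Rightarrow\Delta\mid\Pi\Rightarrow\Sigma$; $Eb,Ec,\Gamma\Rightarrow\Delta,\varphi[x/b]\mid c=\imath x\varphi,\Pi\Rightarrow\Sigma$ and $Eb,Ec,\Gamma\Rightarrow\Delta\mid b=c,c=\imath x\varphi,\Pi\Rightarrow\Sigma$ / $Eb,Ec,\Gamma\Rightarrow\Delta\mid c=\imath x\varphi,\Pi\Rightarrow\Sigma$; $Ec,\Gamma\Rightarrow\Delta\mid\Pi\Rightarrow\Sigma,\varphi[x/c]$ and $Ea,Ec,\varphi[x/a],\Gamma\Rightarrow\Delta\mid\Pi\Rightarrow\Sigma,a=c$ / $Ec,\Gamma\Rightarrow\Delta\mid\Pi\Rightarrow\Sigma,c=\imath x\varphi$; $Ec,\Gamma\Rightarrow\Delta,\varphi[x/c]\mid\Pi\Rightarrow\Sigma$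 and $Ea,Ec,\Gamma\Rightarrow\Delta,a=c\mid\varphi[x/a],\Pi\Rightarrow\Sigma$ / $Ec,\Gamma\Rightarrow\Delta,c=\imath x\varphi\mid\Pi\Rightarrow\Sigma$. -}

module Defs where

open import Data.Nat using (ℕ; suc; _⊔_; _≤_)
open import Data.Nat.Properties using (_≟_)
open import Data.List using (List; []; _∷_; filter; concatMap; _++_)
open import Data.List.Membership.Propositional using (_∈_; _∉_)
open import Data.List.Relation.Unary.All using (All)
open import Data.List.Relation.Binary.Permutation.Propositional using (_↭_)
open import Data.Product using (_×_; ∃)
open import Data.Bool using (Bool; true; false; if_then_else_)
open import Relation.Nullary using (¬_; ¬?; yes; no)
open import Relation.Binary.PropositionalEquality using (_≡_)

data STerm : Set where
  par : ℕ → STerm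
  var : ℕ → STerm

data Fm (T : Set) : Set where
  pr   : ℕ → List T → Fm T
  E    : T → Fm T
  _≐_  : T → T → Fm T
  ¬'   : Fm T → Fm T
  _⇒'_ : Fm T → Fm T → Fm T
  _∧'_ : Fm T → Fm T → Fm T
  ∀'   : ℕ → Fm T → Fm T

Form₀ : Set
Form₀ = Fm STerm

data Term : Set where
  st : STerm → Term
  ι  : ℕ → Form₀ → Term

Form : Set
Form = Fm Term

embF : Form₀ → Form
embF (pr p ts) = pr p (Data.List.map st ts)
embF (E t) = E (st t)
embF (t ≐ s) = st t ≐ st s
embF (¬' φ) = ¬' (embF φ)
embF (φ ⇒' ψ) = embF φ ⇒' embF ψ
embF (φ ∧' ψ) = embF φ ∧' embF ψ
embF (∀' x φ) = ∀' x (embF φ)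

P : ℕ → Term
P a = st (par a)

subFm : {T : Set} → (ℕ → T → T) → ℕ → Fm T → Fm T
subFm f x (pr p ts) = pr p (Data.List.map (f x) ts)
subFm f x (E t) = E (f x t)
subFm f x (t ≐ s) = f x t ≐ f x s
subFm f x (¬' φ) = ¬' (subFm f x φ)
subFm f x (φ ⇒' ψ) = subFm f x φ ⇒' subFm f x ψ
subFm f x (φ ∧' ψ) = subFm f x φ ∧' subFm f x ψ
subFm f x (∀' y φ) with x ≟ y
... | yes _ = ∀' y φ
... | no  _ = ∀' y (subFm f x φ)

subS : STerm → ℕ → STerm → STerm
subS s x (par a) = par a
subS s x (var y) with x ≟ y
... | yes _ = s
... | no  _ = var y

-- Inside the body of a description only a simple term can be substituted
-- (a description inside a description is not a term).  When t is a
-- description the body is left untouched; the rules that substitute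
-- arbitrary terms demand that the result be closed, which excludes the
-- case where x actually occurs there.
subT : Term → ℕ → Term → Term
subT t x (st (par a)) = st (par a)
subT t x (st (var y)) with x ≟ y
... | yes _ = t
... | no  _ = st (var y)
subT t x (ι y φ) with x ≟ y
... | yes _ = ι y φ
... | no  _ with t
...   | st s   = ι y (subFm (subS s) x φ)
...   | ι _ _  = ι y φ

_[_≔_] : Form → ℕ → Term → Form
φ [ x ≔ t ] = subFm (subT t) x φ

_[_≔₀_] : Form₀ → ℕ → STerm → Form₀
φ [ x ≔₀ s ] = subFm (subS s) x φ

parsFm : {T : Set} → (T → List ℕ) → Fm T → List ℕ
parsFm f (pr p ts) = concatMap f ts
parsFm f (E t) = f t
parsFm f (t ≐ s) = f t ++ f s
parsFm f (¬' φ) = parsFm f φ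
parsFm f (φ ⇒' ψ) = parsFm f φ ++ parsFm f ψ
parsFm f (φ ∧' ψ) = parsFm f φ ++ parsFm f ψ
parsFm f (∀' y φ) = parsFm f φ

parsS : STerm → List ℕ
parsS (par a) = a ∷ []
parsS (var _) = []

parsT : Term → List ℕ
parsT (st s) = parsS s
parsT (ι _ φ) = parsFm parsS φ

parsF : Form → List ℕ
parsF = parsFm parsT

remove : ℕ → List ℕ → List ℕ
remove y = filter (λ z → ¬? (z ≟ y))

fvFm : {T : Set} → (T → List ℕ) → Fm T → List ℕ
fvFm f (pr p ts) = concatMap f ts
fvFm f (E t) = f t
fvFm f (t ≐ s) = f t ++ f s
fvFm f (¬' φ) = fvFm f φ
fvFm f (φ ⇒' ψ) = fvFm f φ ++ fvFm f ψ
fvFm f (φ ∧' ψ) = fvFm f φ ++ fvFm f ψ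
fvFm f (∀' y φ) = remove y (fvFm f φ)

fvS : STerm → List ℕ
fvS (par _) = []
fvS (var y) = y ∷ []

fvT : Term → List ℕ
fvT (st s) = fvS s
fvT (ι y φ) = remove y (fvFm fvS φ)

ClosedT : Term → Set
ClosedT t = fvT t ≡ []

Closed : Form → Set
Closed φ = fvFm fvT φ ≡ []

-- Bisequents  Γ ⇒ Δ ∣ Π ⇒ Σ  (components are multisets, represented by
-- lists taken up to permutation)

record BiSeq : Set where
  constructor bs
  field
    ant₁ suc₁ ant₂ suc₂ : List Form

parsL : List Form → List ℕ
parsL = concatMap parsF

parsB : BiSeq → List ℕ
parsB (bs Γ Δ Π Σ) = parsL Γ ++ parsL Δ ++ parsL Π ++ parsL Σ

Fresh : ℕ → BiSeq → Set
Fresh a B = a ∉ parsB B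

_≈B_ : BiSeq → BiSeq → Set
bs Γ Δ Π Σ ≈B bs Γ' Δ' Π' Σ' = (Γ ↭ Γ') × (Δ ↭ Δ') × (Π ↭ Π') × (Σ ↭ Σ')

data Atomic : Form → Set where
  at-pr : ∀ {p ts} → Atomic (pr p ts)
  at-E  : ∀ {t} → Atomic (E t)
  at-eq : ∀ {t s} → Atomic (t ≐ s)

data AtomId : Form → Set where
  ai-pr : ∀ {p ts} → AtomId (pr p ts)
  ai-eq : ∀ {t s} → AtomId (t ≐ s)

data IsDesc : Term → Set where
  isDesc : ∀ {x φ} → IsDesc (ι x φ)

data ParDesc : Term → Term → Set where
  pd : ∀ {a d} → IsDesc d → ParDesc (P a) d
  dp : ∀ {a d} → IsDesc d → ParDesc d (P a)

data ExAtom : Form → Set where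
  ex-pr : ∀ {p ts} → ExAtom (pr p ts)
  ex-eq : ∀ {t s} → ¬ ParDesc t s → ExAtom (t ≐ s)

args : Form → List Term
args (pr p ts) = ts
args (t ≐ s) = t ∷ s ∷ []
args _ = []

HasE : List Form → List Term → Set
HasE Γ ts = All (λ t → E t ∈ Γ) ts

data Logic : Set where
  K3 K3w : Logic

data Rule : Logic → List BiSeq → BiSeq → Set where
  ax-ΓΣ : ∀ {L A Γ Δ Π Σ} → Atomic A → Rule L [] (bs (A ∷ Γ) Δ Π (A ∷ Σ))
  ax-ΓΔ : ∀ {L A Γ Δ Π Σ} → Atomic A → Rule L [] (bs (A ∷ Γ) (A ∷ Δ) Π Σ)
  ax-ΠΣ : ∀ {L A Γ Δ Π Σ} → Atomic A → Rule L [] (bs Γ Δ (A ∷ Π) (A ∷ Σ))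
  ax-E  : ∀ {L A Γ Δ Π Σ} → AtomId A → HasE Γ (args A) →
          Rule L [] (bs Γ (A ∷ Δ) (A ∷ Π) Σ)
  ¬-ll : ∀ {L φ Γ Δ Π Σ} → Rule L (bs Γ Δ Π (φ ∷ Σ) ∷ []) (bs (¬' φ ∷ Γ) Δ Π Σ)
  ¬-lr : ∀ {L φ Γ Δ Π Σ} → Rule L (bs Γ Δ (φ ∷ Π) Σ ∷ []) (bs Γ (¬' φ ∷ Δ) Π Σ)
  ¬-rl : ∀ {L φ Γ Δ Π Σ} → Rule L (bs Γ (φ ∷ Δ) Π Σ ∷ []) (bs Γ Δ (¬' φ ∷ Π) Σ)
  ¬-rr : ∀ {L φ Γ Δ Π Σ} → Rule L (bs (φ ∷ Γ) Δ Π Σ ∷ []) (bs Γ Δ Π (¬' φ ∷ Σ))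
  ∧-ll : ∀ {L φ ψ Γ Δ Π Σ} →
         Rule L (bs (φ ∷ ψ ∷ Γ) Δ Π Σ ∷ []) (bs (φ ∧' ψ ∷ Γ) Δ Π Σ)
  ∧-lr : ∀ {L φ ψ Γ Δ Π Σ} →
         Rule L (bs Γ (φ ∷ Δ) Π Σ ∷ bs Γ (ψ ∷ Δ) Π Σ ∷ []) (bs Γ (φ ∧' ψ ∷ Δ) Π Σ)
  ⇒-rr : ∀ {L φ ψ Γ Δ Π Σ} →
         Rule L (bs (φ ∷ Γ) Δ Π (ψ ∷ Σ) ∷ []) (bs Γ Δ Π (φ ⇒' ψ ∷ Σ))
  ⇒-rl : ∀ {L φ ψ Γ Δ Π Σ} →
         Rule L (bs Γ (φ ∷ Δ) Π Σ ∷ bs Γ Δ (ψ ∷ Π) Σ ∷ []) (bs Γ Δ (φ ⇒' ψ ∷ Π) Σ)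
  ∧-rl : ∀ {φ ψ Γ Δ Π Σ} →
         Rule K3 (bs Γ Δ (φ ∷ ψ ∷ Π) Σ ∷ []) (bs Γ Δ (φ ∧' ψ ∷ Π) Σ)
  ∧-rr : ∀ {φ ψ Γ Δ Π Σ} →
         Rule K3 (bs Γ Δ Π (φ ∷ Σ) ∷ bs Γ Δ Π (ψ ∷ Σ) ∷ []) (bs Γ Δ Π (φ ∧' ψ ∷ Σ))
  ⇒-lr : ∀ {φ ψ Γ Δ Π Σ} →
         Rule K3 (bs Γ (ψ ∷ Δ) (φ ∷ Π) Σ ∷ []) (bs Γ (φ ⇒' ψ ∷ Δ) Π Σ)
  ⇒-ll : ∀ {φ ψ Γ Δ Π Σ} →
         Rule K3 (bs Γ Δ Π (φ ∷ Σ) ∷ bs (ψ ∷ Γ) Δ Π Σ ∷ []) (bs (φ ⇒' ψ ∷ Γ) Δ Π Σ)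
  ∧-rlʷ : ∀ {φ ψ Γ Δ Π Σ} →
         Rule K3w (bs Γ Δ (φ ∷ ψ ∷ Π) Σ ∷ bs Γ (φ ∷ Δ) (φ ∷ Π) Σ ∷
                   bs Γ (ψ ∷ Δ) (ψ ∷ Π) Σ ∷ []) (bs Γ Δ (φ ∧' ψ ∷ Π) Σ)
  ∧-rrʷ : ∀ {φ ψ Γ Δ Π Σ} →
         Rule K3w (bs Γ Δ Π (φ ∷ ψ ∷ Σ) ∷ bs (φ ∷ Γ) Δ Π (ψ ∷ Σ) ∷
                   bs (ψ ∷ Γ) Δ Π (φ ∷ Σ) ∷ []) (bs Γ Δ Π (φ ∧' ψ ∷ Σ))
  ⇒-lrʷ : ∀ {φ ψ Γ Δ Π Σ} →
         Rule K3w (bs Γ (ψ ∷ Δ) (φ ∷ Π) Σ ∷ bs Γ (φ ∷ Δ) (φ ∷ Π) Σ ∷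
                   bs Γ (ψ ∷ Δ) (ψ ∷ Π) Σ ∷ []) (bs Γ (φ ⇒' ψ ∷ Δ) Π Σ)
  ⇒-llʷ : ∀ {φ ψ Γ Δ Π Σ} →
         Rule K3w (bs (φ ∷ ψ ∷ Γ) Δ Π Σ ∷ bs Γ Δ Π (φ ∷ ψ ∷ Σ) ∷
                   bs (ψ ∷ Γ) Δ Π (φ ∷ Σ) ∷ []) (bs (φ ⇒' ψ ∷ Γ) Δ Π Σ)
  ∀-lr : ∀ {L x φ a Γ Δ Π Σ} → Fresh a (bs Γ (∀' x φ ∷ Δ) Π Σ) →
         Rule L (bs (E (P a) ∷ Γ) (φ [ x ≔ P a ] ∷ Δ) Π Σ ∷ [])
                (bs Γ (∀' x φ ∷ Δ) Π Σ)
  ∀-rr : ∀ {L x φ a Γ Δ Π Σ} → Fresh a (bs Γ Δ Π (∀' x φ ∷ Σ)) →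
         Rule L (bs (E (P a) ∷ Γ) Δ Π (φ [ x ≔ P a ] ∷ Σ) ∷ [])
                (bs Γ Δ Π (∀' x φ ∷ Σ))
  ∀-ll : ∀ {L x φ b Γ Δ Π Σ} →
         Rule L (bs (E (P b) ∷ ∀' x φ ∷ φ [ x ≔ P b ] ∷ Γ) Δ Π Σ ∷ [])
                (bs (E (P b) ∷ ∀' x φ ∷ Γ) Δ Π Σ)
  ∀-rl : ∀ {L x φ b Γ Δ Π Σ} →
         Rule L (bs (E (P b) ∷ Γ) Δ (∀' x φ ∷ φ [ x ≔ P b ] ∷ Π) Σ ∷ [])
                (bs (E (P b) ∷ Γ) Δ (∀' x φ ∷ Π) Σ)
  E-ll : ∀ {L A t Γ Δ Π Σ} → ExAtom A → t ∈ args A →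
         Rule L (bs (E t ∷ A ∷ Γ) Δ Π Σ ∷ []) (bs (A ∷ Γ) Δ Π Σ)
  E-rr : ∀ {L A t Γ Δ Π Σ} → ExAtom A → t ∈ args A →
         Rule L (bs (E t ∷ Γ) Δ Π (A ∷ Σ) ∷ []) (bs Γ Δ Π (A ∷ Σ))
  E-rl : ∀ {L A Γ Δ Π Σ} → ExAtom A → HasE Γ (args A) →
         Rule L (bs (A ∷ Γ) Δ Π Σ ∷ []) (bs Γ Δ (A ∷ Π) Σ)
  E-lr : ∀ {L A Γ Δ Π Σ} → ExAtom A → HasE Γ (args A) →
         Rule L (bs Γ Δ Π (A ∷ Σ) ∷ []) (bs Γ (A ∷ Δ) Π Σ)
  EE-rl : ∀ {L t Γ Δ Π Σ} →
         Rule L (bs (E t ∷ Γ) Δ Π Σ ∷ []) (bs Γ Δ (E t ∷ Π) Σ)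
  EE-lr : ∀ {L t Γ Δ Π Σ} →
         Rule L (bs Γ Δ Π (E t ∷ Σ) ∷ []) (bs Γ (E t ∷ Δ) Π Σ)
  -- identity  (t ≈ s is t = s or s = t)
  ≐-sub : ∀ {L A x t s Γ Δ Π Σ} (swap : Bool) → Atomic A →
         ClosedT t → ClosedT s → Closed (A [ x ≔ t ]) → Closed (A [ x ≔ s ]) →
         Rule L (bs Γ Δ Π ((if swap then (s ≐ t) else (t ≐ s)) ∷ Σ) ∷
                 bs Γ Δ Π (A [ x ≔ t ] ∷ Σ) ∷
                 bs (A [ x ≔ s ] ∷ Γ) Δ Π Σ ∷ [])
                (bs Γ Δ Π Σ)
  ≐-refl : ∀ {L t Γ Δ Π Σ} →
         Rule L (bs (t ≐ t ∷ E t ∷ Γ) Δ Π Σ ∷ []) (bs (E t ∷ Γ) Δ Π Σ)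
  ≐-desc : ∀ {L a d Γ Δ Π Σ} → IsDesc d → Fresh a (bs (E d ∷ Γ) Δ Π Σ) →
         Rule L (bs (P a ≐ d ∷ E d ∷ Γ) Δ Π Σ ∷ []) (bs (E d ∷ Γ) Δ Π Σ)
  ι-ll : ∀ {L x φ c Γ Δ Π Σ} →
         Rule L (bs (embF (φ [ x ≔₀ par c ]) ∷ P c ≐ ι x φ ∷ E (P c) ∷ Γ) Δ Π Σ ∷ [])
                (bs (P c ≐ ι x φ ∷ E (P c) ∷ Γ) Δ Π Σ)
  ι-rl : ∀ {L x φ c Γ Δ Π Σ} →
         Rule L (bs (E (P c) ∷ Γ) Δ (embF (φ [ x ≔₀ par c ]) ∷ P c ≐ ι x φ ∷ Π) Σ ∷ [])
                (bs (E (P c) ∷ Γ) Δ (P c ≐ ι x φ ∷ Π) Σ)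
  ι-ll₂ : ∀ {L x φ b c Γ Δ Π Σ} →
         Rule L (bs (P c ≐ ι x φ ∷ E (P b) ∷ E (P c) ∷ Γ) Δ Π
                    (embF (φ [ x ≔₀ par b ]) ∷ Σ) ∷
                 bs (P b ≐ P c ∷ P c ≐ ι x φ ∷ E (P b) ∷ E (P c) ∷ Γ) Δ Π Σ ∷ [])
                (bs (P c ≐ ι x φ ∷ E (P b) ∷ E (P c) ∷ Γ) Δ Π Σ)
  ι-rl₂ : ∀ {L x φ b c Γ Δ Π Σ} →
         Rule L (bs (E (P b) ∷ E (P c) ∷ Γ) (embF (φ [ x ≔₀ par b ]) ∷ Δ)
                    (P c ≐ ι x φ ∷ Π) Σ ∷
                 bs (E (P b) ∷ E (P c) ∷ Γ) Δ (P b ≐ P c ∷ P c ≐ ι x φ ∷ Π) Σ ∷ [])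
                (bs (E (P b) ∷ E (P c) ∷ Γ) Δ (P c ≐ ι x φ ∷ Π) Σ)
  ι-rr : ∀ {L x φ a c Γ Δ Π Σ} → Fresh a (bs (E (P c) ∷ Γ) Δ Π (P c ≐ ι x φ ∷ Σ)) →
         Rule L (bs (E (P c) ∷ Γ) Δ Π (embF (φ [ x ≔₀ par c ]) ∷ Σ) ∷
                 bs (E (P a) ∷ E (P c) ∷ embF (φ [ x ≔₀ par a ]) ∷ Γ) Δ Π
                    (P a ≐ P c ∷ Σ) ∷ [])
                (bs (E (P c) ∷ Γ) Δ Π (P c ≐ ι x φ ∷ Σ))
  ι-lr : ∀ {L x φ a c Γ Δ Π Σ} → Fresh a (bs (E (P c) ∷ Γ) (P c ≐ ι x φ ∷ Δ) Π Σ) →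
         Rule L (bs (E (P c) ∷ Γ) (embF (φ [ x ≔₀ par c ]) ∷ Δ) Π Σ ∷
                 bs (E (P a) ∷ E (P c) ∷ Γ) (P a ≐ P c ∷ Δ)
                    (embF (φ [ x ≔₀ par a ]) ∷ Π) Σ ∷ [])
                (bs (E (P c) ∷ Γ) (P c ≐ ι x φ ∷ Δ) Π Σ)

-- Derivations and their height (length of the longest branch, counted in
-- nodes).  Each node's conclusion may be any bisequent equal as a
-- multiset-bisequent to the rule's conclusion.

data Deriv (L : Logic) : BiSeq → Set
data Derivs (L : Logic) : List BiSeq → Set

data Deriv L where
  node : ∀ {ps c C} → Rule L ps c → c ≈B C → Derivs L ps → Deriv L C

data Derivs L where
  []  : Derivs L []
  _∷_ : ∀ {B Bs} → Deriv L B → Derivs L Bs → Derivs L (B ∷ Bs)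

height  : ∀ {L B} → Deriv L B → ℕ
heights : ∀ {L Bs} → Derivs L Bs → ℕ
height (node _ _ ds) = suc (heights ds)
heights [] = 0
heights (d ∷ ds) = height d ⊔ heights ds

Derivable≤ : Logic → ℕ → BiSeq → Set
Derivable≤ L n B = ∃ (λ (d : Deriv L B) → height d ≤ n)

{-# OPTIONS --safe #-}

-- Both transfer rules are proved together by induction on the height. Let r be the last rule
-- of a derivation of the premiss. If the transferred formula φ is not principal in r, it lies
-- in the context of r, and r can be reapplied to the transferred premisses: the existence side
-- conditions only consult Γ, which transfer can only enlarge, and eigenvariables stay fresh
-- because transfer changes no parameters. If φ is principal, either the transferred bisequent
-- is a premiss of r (existence rules), or the axiom or rule for φ in its new position applies
-- to transfers of the premisses of r, weakened by one formula for the three-premiss rules of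
-- BSC(K3w). Height-preserving weakening must rename eigenvariables apart, and an injective
-- renaming of parameters maps a derivation to one of the same height.

module Submission where

open import Defs
open import Data.Bool using (true; false; if_then_else_)
open import Data.Empty using (⊥-elim)
open import Data.List using (List; []; _∷_; _++_; map; concatMap)
open import Data.List.Extrema.Nat using (max; xs≤max)
open import Data.List.Membership.Propositional using (_∈_; _∉_; find; lose)
open import Data.List.Membership.Propositional.Properties
  using (∈-++⁺ˡ; ∈-++⁺ʳ; ∈-++⁻; ∈-map⁺; ∈-map⁻; ∈-concatMap⁺; ∈-concatMap⁻; ∈-∃++)
open import Data.List.Properties using (++-assoc; map-++; map-∘; map-cong)
open import Data.List.Relation.Binary.Permutation.Propositional
  using (_↭_; ↭-refl; ↭-sym; ↭-trans; ↭-reflexive; prep; swap)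
open import Data.List.Relation.Binary.Permutation.Propositional.Properties
  using (∈-resp-↭; ++⁺ˡ; ++⁺ʳ; ++-identityʳ; shift; drop-∷; ∷↭∷ʳ; map⁺)
open import Data.List.Relation.Binary.Subset.Propositional using (_⊆_)
open import Data.List.Relation.Unary.All as All using (All; []; _∷_)
import Data.List.Relation.Unary.All.Properties as All
open import Data.List.Relation.Unary.Any using (here; there)
open import Data.Nat using (ℕ; zero; suc; _≤_; s≤s; z≤n)
open import Data.Nat.Properties using (_≟_; m≤n⇒m≤1+n; ⊔-lub; m⊔n≤o⇒m≤o; m⊔n≤o⇒n≤o; <-irrefl)
open import Data.Product using (_×_; _,_; ∃; proj₁; proj₂)
open import Data.Sum as Sum using (_⊎_; inj₁; inj₂)
open import Function using (_∘_)
open import Function.Definitions using (Injective)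
open import Relation.Nullary using (¬_; yes; no)
open import Relation.Binary.PropositionalEquality
  using (_≡_; _≢_; refl; sym; trans; cong; cong₂; subst; module ≡-Reasoning)

open BiSeq

private
  variable
    L : Logic
    n : ℕ
    a a′ : ℕ
    χ : Form
    Γ Δ Π Σ Γ′ Δ′ Π′ Σ′ : List Form
    B C D : BiSeq
    ps : List BiSeq

≈B-refl : B ≈B B
≈B-refl {bs _ _ _ _} = ↭-refl , ↭-refl , ↭-refl , ↭-refl

≈B-sym : B ≈B C → C ≈B B
≈B-sym {bs _ _ _ _} {bs _ _ _ _} (p , q , r , s) = ↭-sym p , ↭-sym q , ↭-sym r , ↭-sym s

≈B-trans : B ≈B C → C ≈B D → B ≈B D
≈B-trans {bs _ _ _ _} {bs _ _ _ _} {bs _ _ _ _} (p , q , r , s) (p′ , q′ , r′ , s′) =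
  ↭-trans p p′ , ↭-trans q q′ , ↭-trans r r′ , ↭-trans s s′

Derivable≤-resp-≈B : B ≈B C → Derivable≤ L n B → Derivable≤ L n C
Derivable≤-resp-≈B B≈C (node r c≈B ds , h) = node r (≈B-trans c≈B B≈C) ds , h

Derivable≤-suc : Derivable≤ L n B → Derivable≤ L (suc n) B
Derivable≤-suc (d , h) = d , m≤n⇒m≤1+n h

¬Derivable≤-zero : ¬ Derivable≤ L 0 B
¬Derivable≤-zero (node _ _ _ , ())

heights≤⇒All : (ds : Derivs L ps) → heights ds ≤ n → All (Derivable≤ L n) ps
heights≤⇒All []       _ = []
heights≤⇒All (d ∷ ds) h = (d , m⊔n≤o⇒m≤o _ _ h) ∷ heights≤⇒All ds (m⊔n≤o⇒n≤o _ _ h)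

All⇒heights≤ : All (Derivable≤ L n) ps → ∃ λ (ds : Derivs L ps) → heights ds ≤ n
All⇒heights≤ []             = [] , z≤n
All⇒heights≤ ((d , h) ∷ ds) with ds′ , h′ ← All⇒heights≤ ds = d ∷ ds′ , ⊔-lub h h′

record LastRule (L : Logic) (n : ℕ) (C : BiSeq) : Set where
  constructor lastRule
  field
    {premisses}         : List BiSeq
    {conclusion}        : BiSeq
    rule                : Rule L premisses conclusion
    conclusion≈         : conclusion ≈B C
    premisses-derivable : All (Derivable≤ L n) premisses

inversion : Derivable≤ L (suc n) C → LastRule L n C
inversion (node r c≈C ds , s≤s h) = lastRule r c≈C (heights≤⇒All ds h)

byRule : Rule L ps B → B ≈B C → All (Derivable≤ L n) ps → Derivable≤ L (suc n) C
byRule r B≈C ds with ds′ , h ← All⇒heights≤ ds = node r B≈C ds′ , s≤s h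

byRule′ : Rule L ps B → All (Derivable≤ L n) ps → Derivable≤ L (suc n) B
byRule′ r = byRule r ≈B-refl

infixl 25 _⊕_
_⊕_ : BiSeq → BiSeq → BiSeq
B ⊕ C = bs (ant₁ B ++ ant₁ C) (suc₁ B ++ suc₁ C) (ant₂ B ++ ant₂ C) (suc₂ B ++ suc₂ C)

⊕-assoc : ∀ B C D → B ⊕ (C ⊕ D) ≈B B ⊕ C ⊕ D
⊕-assoc B C D =
  ↭-reflexive (sym (++-assoc (ant₁ B) (ant₁ C) (ant₁ D))) ,
  ↭-reflexive (sym (++-assoc (suc₁ B) (suc₁ C) (suc₁ D))) ,
  ↭-reflexive (sym (++-assoc (ant₂ B) (ant₂ C) (ant₂ D))) ,
  ↭-reflexive (sym (++-assoc (suc₂ B) (suc₂ C) (suc₂ D)))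

⊕-respˡ-≈B : ∀ D → B ≈B C → B ⊕ D ≈B C ⊕ D
⊕-respˡ-≈B D (p , q , r , s) = ++⁺ʳ (ant₁ D) p , ++⁺ʳ (suc₁ D) q , ++⁺ʳ (ant₂ D) r , ++⁺ʳ (suc₂ D) s

infix 4 _∈B_ _⊆B_

_∈B_ : Form → BiSeq → Set
χ ∈B B = χ ∈ ant₁ B ⊎ χ ∈ suc₁ B ⊎ χ ∈ ant₂ B ⊎ χ ∈ suc₂ B

_⊆B_ : BiSeq → BiSeq → Set
B ⊆B C = ∀ {χ} → χ ∈B B → χ ∈B C

≈B⇒⊆B : B ≈B C → B ⊆B C
≈B⇒⊆B {bs _ _ _ _} {bs _ _ _ _} (p , q , r , s) =
  Sum.map (∈-resp-↭ p) (Sum.map (∈-resp-↭ q) (Sum.map (∈-resp-↭ r) (∈-resp-↭ s)))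

⊆B-⊕ʳ : ∀ B D → B ⊆B B ⊕ D
⊆B-⊕ʳ B D = Sum.map ∈-++⁺ˡ (Sum.map ∈-++⁺ˡ (Sum.map ∈-++⁺ˡ ∈-++⁺ˡ))

⊆B-⊕ˡ : ∀ B D → D ⊆B B ⊕ D
⊆B-⊕ˡ B D = Sum.map (∈-++⁺ʳ _) (Sum.map (∈-++⁺ʳ _) (Sum.map (∈-++⁺ʳ _) (∈-++⁺ʳ _)))

transferˡ-⊆B : bs (χ ∷ Γ) Δ Π Σ ⊆B bs Γ Δ (χ ∷ Π) Σ
transferˡ-⊆B (inj₁ (here refl))     = inj₂ (inj₂ (inj₁ (here refl)))
transferˡ-⊆B (inj₁ (there m))       = inj₁ m
transferˡ-⊆B (inj₂ (inj₁ m))        = inj₂ (inj₁ m)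
transferˡ-⊆B (inj₂ (inj₂ (inj₁ m))) = inj₂ (inj₂ (inj₁ (there m)))
transferˡ-⊆B (inj₂ (inj₂ (inj₂ m))) = inj₂ (inj₂ (inj₂ m))

transferʳ-⊆B : bs Γ Δ Π (χ ∷ Σ) ⊆B bs Γ (χ ∷ Δ) Π Σ
transferʳ-⊆B (inj₁ m)                         = inj₁ m
transferʳ-⊆B (inj₂ (inj₁ m))                  = inj₂ (inj₁ (there m))
transferʳ-⊆B (inj₂ (inj₂ (inj₁ m)))           = inj₂ (inj₂ (inj₁ m))
transferʳ-⊆B (inj₂ (inj₂ (inj₂ (here refl)))) = inj₂ (inj₁ (here refl))
transferʳ-⊆B (inj₂ (inj₂ (inj₂ (there m))))   = inj₂ (inj₂ (inj₂ m))

∈-parsL⁻ : ∀ Γ → a ∈ parsL Γ → ∃ λ χ → χ ∈ Γ × a ∈ parsF χ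
∈-parsL⁻ Γ = find ∘ ∈-concatMap⁻ parsF

∈-parsL⁺ : ∀ Γ → χ ∈ Γ → a ∈ parsF χ → a ∈ parsL Γ
∈-parsL⁺ Γ χ∈Γ a∈χ = ∈-concatMap⁺ parsF (lose χ∈Γ a∈χ)

∈-parsB⁻ : ∀ B → a ∈ parsB B → ∃ λ χ → χ ∈B B × a ∈ parsF χ
∈-parsB⁻ (bs Γ Δ Π Σ) a∈B with ∈-++⁻ (parsL Γ) a∈B
... | inj₁ a∈Γ = let χ , χ∈ , a∈χ = ∈-parsL⁻ Γ a∈Γ in χ , inj₁ χ∈ , a∈χ
... | inj₂ a∈ΔΠΣ with ∈-++⁻ (parsL Δ) a∈ΔΠΣ
...   | inj₁ a∈Δ = let χ , χ∈ , a∈χ = ∈-parsL⁻ Δ a∈Δ in χ , inj₂ (inj₁ χ∈) , a∈χ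
...   | inj₂ a∈ΠΣ with ∈-++⁻ (parsL Π) a∈ΠΣ
...     | inj₁ a∈Π = let χ , χ∈ , a∈χ = ∈-parsL⁻ Π a∈Π in χ , inj₂ (inj₂ (inj₁ χ∈)) , a∈χ
...     | inj₂ a∈Σ = let χ , χ∈ , a∈χ = ∈-parsL⁻ Σ a∈Σ in χ , inj₂ (inj₂ (inj₂ χ∈)) , a∈χ

∈-parsB⁺ : ∀ B → χ ∈B B → a ∈ parsF χ → a ∈ parsB B
∈-parsB⁺ (bs Γ Δ Π Σ) (inj₁ χ∈)               a∈χ = ∈-++⁺ˡ (∈-parsL⁺ Γ χ∈ a∈χ)
∈-parsB⁺ (bs Γ Δ Π Σ) (inj₂ (inj₁ χ∈))        a∈χ =
  ∈-++⁺ʳ (parsL Γ) (∈-++⁺ˡ (∈-parsL⁺ Δ χ∈ a∈χ))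
∈-parsB⁺ (bs Γ Δ Π Σ) (inj₂ (inj₂ (inj₁ χ∈))) a∈χ =
  ∈-++⁺ʳ (parsL Γ) (∈-++⁺ʳ (parsL Δ) (∈-++⁺ˡ (∈-parsL⁺ Π χ∈ a∈χ)))
∈-parsB⁺ (bs Γ Δ Π Σ) (inj₂ (inj₂ (inj₂ χ∈))) a∈χ =
  ∈-++⁺ʳ (parsL Γ) (∈-++⁺ʳ (parsL Δ) (∈-++⁺ʳ (parsL Π) (∈-parsL⁺ Σ χ∈ a∈χ)))

Fresh-⊆B : C ⊆B B → Fresh a B → Fresh a C
Fresh-⊆B {C} {B} C⊆B a∉B a∈C with χ , χ∈C , a∈χ ← ∈-parsB⁻ C a∈C =
  a∉B (∈-parsB⁺ B (C⊆B χ∈C) a∈χ)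

Fresh⇒∉parsF : Fresh a B → χ ∈B B → a ∉ parsF χ
Fresh⇒∉parsF {B = B} a∉B χ∈B a∈χ = a∉B (∈-parsB⁺ B χ∈B a∈χ)

Fresh-transferʳ : ∀ {a χ Γ Δ Π Σ} → Fresh a (bs Γ (χ ∷ Δ) Π Σ) → Fresh a (bs Γ Δ Π (χ ∷ Σ))
Fresh-transferʳ {a} {χ} {Γ} {Δ} {Π} {Σ} =
  Fresh-⊆B {C = bs Γ Δ Π (χ ∷ Σ)} {B = bs Γ (χ ∷ Δ) Π Σ} transferʳ-⊆B

fresh : List ℕ → ℕ
fresh xs = suc (max 0 xs)

fresh-∉ : ∀ xs → fresh xs ∉ xs
fresh-∉ xs m = <-irrefl refl (All.lookup (xs≤max 0 xs) m)

mapFm : {T : Set} → (T → T) → Fm T → Fm T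
mapFm g (pr p ts) = pr p (map g ts)
mapFm g (E t)     = E (g t)
mapFm g (t ≐ s)   = g t ≐ g s
mapFm g (¬' φ)    = ¬' (mapFm g φ)
mapFm g (φ ⇒' ψ)  = mapFm g φ ⇒' mapFm g ψ
mapFm g (φ ∧' ψ)  = mapFm g φ ∧' mapFm g ψ
mapFm g (∀' y φ)  = ∀' y (mapFm g φ)

renS : (ℕ → ℕ) → STerm → STerm
renS ρ (par a) = par (ρ a)
renS ρ (var y) = var y

ren₀ : (ℕ → ℕ) → Form₀ → Form₀
ren₀ ρ = mapFm (renS ρ)

renT : (ℕ → ℕ) → Term → Term
renT ρ (st s)  = st (renS ρ s)
renT ρ (ι y φ) = ι y (ren₀ ρ φ)

ren : (ℕ → ℕ) → Form → Form
ren ρ = mapFm (renT ρ)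

renL : (ℕ → ℕ) → List Form → List Form
renL ρ = map (ren ρ)

renB : (ℕ → ℕ) → BiSeq → BiSeq
renB ρ (bs Γ Δ Π Σ) = bs (renL ρ Γ) (renL ρ Δ) (renL ρ Π) (renL ρ Σ)

module _ {T : Set} where

  mapFm-subFm : (f f′ : ℕ → T → T) (g : T → T) (x : ℕ) → (∀ t → g (f x t) ≡ f′ x (g t)) →
                ∀ φ → mapFm g (subFm f x φ) ≡ subFm f′ x (mapFm g φ)
  mapFm-subFm f f′ g x comm (pr p ts) = cong (pr p) (go ts)
    where
    go : ∀ ts → map g (map (f x) ts) ≡ map (f′ x) (map g ts)
    go []       = refl
    go (t ∷ ts) = cong₂ _∷_ (comm t) (go ts)
  mapFm-subFm f f′ g x comm (E t)    = cong E (comm t)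
  mapFm-subFm f f′ g x comm (t ≐ s)  = cong₂ _≐_ (comm t) (comm s)
  mapFm-subFm f f′ g x comm (¬' φ)   = cong ¬' (mapFm-subFm f f′ g x comm φ)
  mapFm-subFm f f′ g x comm (φ ⇒' ψ) = cong₂ _⇒'_ (mapFm-subFm f f′ g x comm φ) (mapFm-subFm f f′ g x comm ψ)
  mapFm-subFm f f′ g x comm (φ ∧' ψ) = cong₂ _∧'_ (mapFm-subFm f f′ g x comm φ) (mapFm-subFm f f′ g x comm ψ)
  mapFm-subFm f f′ g x comm (∀' y φ) with x ≟ y
  ... | yes _ = refl
  ... | no  _ = cong (∀' y) (mapFm-subFm f f′ g x comm φ)

  fvFm-mapFm : (f : T → List ℕ) (g : T → T) → (∀ t → f (g t) ≡ f t) → ∀ φ → fvFm f (mapFm g φ) ≡ fvFm f φ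
  fvFm-mapFm f g fg≡f (pr p ts) = go ts
    where
    go : ∀ ts → concatMap f (map g ts) ≡ concatMap f ts
    go []       = refl
    go (t ∷ ts) = cong₂ _++_ (fg≡f t) (go ts)
  fvFm-mapFm f g fg≡f (E t)    = fg≡f t
  fvFm-mapFm f g fg≡f (t ≐ s)  = cong₂ _++_ (fg≡f t) (fg≡f s)
  fvFm-mapFm f g fg≡f (¬' φ)   = fvFm-mapFm f g fg≡f φ
  fvFm-mapFm f g fg≡f (φ ⇒' ψ) = cong₂ _++_ (fvFm-mapFm f g fg≡f φ) (fvFm-mapFm f g fg≡f ψ)
  fvFm-mapFm f g fg≡f (φ ∧' ψ) = cong₂ _++_ (fvFm-mapFm f g fg≡f φ) (fvFm-mapFm f g fg≡f ψ)
  fvFm-mapFm f g fg≡f (∀' y φ) = cong (remove y) (fvFm-mapFm f g fg≡f φ)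

  parsFm-mapFm : (f : T → List ℕ) (g : T → T) (ρ : ℕ → ℕ) → (∀ t → f (g t) ≡ map ρ (f t)) →
                 ∀ φ → parsFm f (mapFm g φ) ≡ map ρ (parsFm f φ)
  parsFm-mapFm f g ρ comm (pr p ts) = go ts
    where
    go : ∀ ts → concatMap f (map g ts) ≡ map ρ (concatMap f ts)
    go []       = refl
    go (t ∷ ts) = trans (cong₂ _++_ (comm t) (go ts)) (sym (map-++ ρ (f t) (concatMap f ts)))
  parsFm-mapFm f g ρ comm (E t)    = comm t
  parsFm-mapFm f g ρ comm (t ≐ s)  = trans (cong₂ _++_ (comm t) (comm s)) (sym (map-++ ρ (f t) (f s)))
  parsFm-mapFm f g ρ comm (¬' φ)   = parsFm-mapFm f g ρ comm φ
  parsFm-mapFm f g ρ comm (φ ⇒' ψ) =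
    trans (cong₂ _++_ (parsFm-mapFm f g ρ comm φ) (parsFm-mapFm f g ρ comm ψ))
          (sym (map-++ ρ (parsFm f φ) (parsFm f ψ)))
  parsFm-mapFm f g ρ comm (φ ∧' ψ) =
    trans (cong₂ _++_ (parsFm-mapFm f g ρ comm φ) (parsFm-mapFm f g ρ comm ψ))
          (sym (map-++ ρ (parsFm f φ) (parsFm f ψ)))
  parsFm-mapFm f g ρ comm (∀' y φ) = parsFm-mapFm f g ρ comm φ

module _ (ρ : ℕ → ℕ) where

  renS-subS : ∀ s x u → renS ρ (subS s x u) ≡ subS (renS ρ s) x (renS ρ u)
  renS-subS s x (par a) = refl
  renS-subS s x (var y) with x ≟ y
  ... | yes _ = refl
  ... | no  _ = refl

  ren₀-[≔₀] : ∀ φ x s → ren₀ ρ (φ [ x ≔₀ s ]) ≡ ren₀ ρ φ [ x ≔₀ renS ρ s ]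
  ren₀-[≔₀] φ x s = mapFm-subFm (subS s) (subS (renS ρ s)) (renS ρ) x (renS-subS s x) φ

  renT-subT : ∀ t x u → renT ρ (subT t x u) ≡ subT (renT ρ t) x (renT ρ u)
  renT-subT t x (st (par a)) = refl
  renT-subT t x (st (var y)) with x ≟ y
  ... | yes _ = refl
  ... | no  _ = refl
  renT-subT t x (ι y φ) with x ≟ y
  ... | yes _ = refl
  ... | no  _ with t
  ...   | st s  = cong (ι y) (ren₀-[≔₀] φ x s)
  ...   | ι _ _ = refl

  ren-[≔] : ∀ φ x t → ren ρ (φ [ x ≔ t ]) ≡ ren ρ φ [ x ≔ renT ρ t ]
  ren-[≔] φ x t = mapFm-subFm (subT t) (subT (renT ρ t)) (renT ρ) x (renT-subT t x) φ

  ren-embF : ∀ φ → ren ρ (embF φ) ≡ embF (ren₀ ρ φ)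
  ren-embF (pr p ts) = cong (pr p) (go ts)
    where
    go : ∀ ts → map (renT ρ) (map st ts) ≡ map st (map (renS ρ) ts)
    go []       = refl
    go (t ∷ ts) = cong (_ ∷_) (go ts)
  ren-embF (E t)    = refl
  ren-embF (t ≐ s)  = refl
  ren-embF (¬' φ)   = cong ¬' (ren-embF φ)
  ren-embF (φ ⇒' ψ) = cong₂ _⇒'_ (ren-embF φ) (ren-embF ψ)
  ren-embF (φ ∧' ψ) = cong₂ _∧'_ (ren-embF φ) (ren-embF ψ)
  ren-embF (∀' y φ) = cong (∀' y) (ren-embF φ)

  ren-embF[≔₀] : ∀ φ x c → ren ρ (embF (φ [ x ≔₀ par c ])) ≡ embF (ren₀ ρ φ [ x ≔₀ par (ρ c) ])
  ren-embF[≔₀] φ x c = trans (ren-embF (φ [ x ≔₀ par c ])) (cong embF (ren₀-[≔₀] φ x (par c)))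

  fvT-renT : ∀ t → fvT (renT ρ t) ≡ fvT t
  fvT-renT (st (par a)) = refl
  fvT-renT (st (var y)) = refl
  fvT-renT (ι y φ)      = cong (remove y) (fvFm-mapFm fvS (renS ρ) fvS-renS φ)
    where
    fvS-renS : ∀ s → fvS (renS ρ s) ≡ fvS s
    fvS-renS (par a) = refl
    fvS-renS (var y) = refl

  ClosedT-renT : ∀ t → ClosedT t → ClosedT (renT ρ t)
  ClosedT-renT t = trans (fvT-renT t)

  Closed-ren : ∀ φ → Closed φ → Closed (ren ρ φ)
  Closed-ren φ = trans (fvFm-mapFm fvT (renT ρ) fvT-renT φ)

  parsT-renT : ∀ t → parsT (renT ρ t) ≡ map ρ (parsT t)
  parsT-renT (st (par a)) = refl
  parsT-renT (st (var y)) = refl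
  parsT-renT (ι y φ)      = parsFm-mapFm parsS (renS ρ) ρ parsS-renS φ
    where
    parsS-renS : ∀ s → parsS (renS ρ s) ≡ map ρ (parsS s)
    parsS-renS (par a) = refl
    parsS-renS (var y) = refl

  parsL-renL : ∀ Γ → parsL (renL ρ Γ) ≡ map ρ (parsL Γ)
  parsL-renL []      = refl
  parsL-renL (χ ∷ Γ) =
    trans (cong₂ _++_ (parsFm-mapFm parsT (renT ρ) ρ parsT-renT χ) (parsL-renL Γ))
          (sym (map-++ ρ (parsF χ) (parsL Γ)))

  parsB-renB : ∀ B → parsB (renB ρ B) ≡ map ρ (parsB B)
  parsB-renB (bs Γ Δ Π Σ) =
    trans (cong₂ _++_ (parsL-renL Γ) (cong₂ _++_ (parsL-renL Δ) (cong₂ _++_ (parsL-renL Π) (parsL-renL Σ))))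
          (sym (trans (map-++ ρ (parsL Γ) _) (cong (map ρ (parsL Γ) ++_)
                (trans (map-++ ρ (parsL Δ) _) (cong (map ρ (parsL Δ) ++_) (map-++ ρ (parsL Π) _))))))

  Fresh-renB : Injective _≡_ _≡_ ρ → ∀ B → Fresh a B → Fresh (ρ a) (renB ρ B)
  Fresh-renB inj B a∉B ρa∈ρB with b , b∈B , ρa≡ρb ← ∈-map⁻ ρ (subst (_ ∈_) (parsB-renB B) ρa∈ρB)
    rewrite inj ρa≡ρb = a∉B b∈B

  renB-⊕ : ∀ B C → renB ρ (B ⊕ C) ≡ renB ρ B ⊕ renB ρ C
  renB-⊕ B C = cong₄ (map-++ _ (ant₁ B) (ant₁ C)) (map-++ _ (suc₁ B) (suc₁ C))
                     (map-++ _ (ant₂ B) (ant₂ C)) (map-++ _ (suc₂ B) (suc₂ C))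
    where
    cong₄ : ∀ {Γ Δ Π Σ Γ′ Δ′ Π′ Σ′} → Γ ≡ Γ′ → Δ ≡ Δ′ → Π ≡ Π′ → Σ ≡ Σ′ → bs Γ Δ Π Σ ≡ bs Γ′ Δ′ Π′ Σ′
    cong₄ refl refl refl refl = refl

Fixes : (ℕ → ℕ) → List ℕ → Set
Fixes ρ xs = ∀ {b} → b ∈ xs → ρ b ≡ b

module _ {ρ : ℕ → ℕ} where

  mapFm-id : {T : Set} (f : T → List ℕ) (g : T → T) → (∀ t → Fixes ρ (f t) → g t ≡ t) →
             ∀ φ → Fixes ρ (parsFm f φ) → mapFm g φ ≡ φ
  mapFm-id f g g-id (pr p ts) fix = cong (pr p) (go ts fix)
    where
    go : ∀ ts → Fixes ρ (concatMap f ts) → map g ts ≡ ts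
    go []       _   = refl
    go (t ∷ ts) fix = cong₂ _∷_ (g-id t (fix ∘ ∈-++⁺ˡ)) (go ts (fix ∘ ∈-++⁺ʳ (f t)))
  mapFm-id f g g-id (E t)    fix = cong E (g-id t fix)
  mapFm-id f g g-id (t ≐ s)  fix = cong₂ _≐_ (g-id t (fix ∘ ∈-++⁺ˡ)) (g-id s (fix ∘ ∈-++⁺ʳ (f t)))
  mapFm-id f g g-id (¬' φ)   fix = cong ¬' (mapFm-id f g g-id φ fix)
  mapFm-id f g g-id (φ ⇒' ψ) fix =
    cong₂ _⇒'_ (mapFm-id f g g-id φ (fix ∘ ∈-++⁺ˡ)) (mapFm-id f g g-id ψ (fix ∘ ∈-++⁺ʳ (parsFm f φ)))
  mapFm-id f g g-id (φ ∧' ψ) fix =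
    cong₂ _∧'_ (mapFm-id f g g-id φ (fix ∘ ∈-++⁺ˡ)) (mapFm-id f g g-id ψ (fix ∘ ∈-++⁺ʳ (parsFm f φ)))
  mapFm-id f g g-id (∀' y φ) fix = cong (∀' y) (mapFm-id f g g-id φ fix)

  renS-id : ∀ s → Fixes ρ (parsS s) → renS ρ s ≡ s
  renS-id (par a) fix = cong par (fix (here refl))
  renS-id (var y) fix = refl

  ren₀-id : ∀ φ → Fixes ρ (parsFm parsS φ) → ren₀ ρ φ ≡ φ
  ren₀-id = mapFm-id parsS (renS ρ) renS-id

  renT-id : ∀ t → Fixes ρ (parsT t) → renT ρ t ≡ t
  renT-id (st s)  fix = cong st (renS-id s fix)
  renT-id (ι y φ) fix = cong (ι y) (ren₀-id φ fix)

  ren-id : ∀ φ → Fixes ρ (parsF φ) → ren ρ φ ≡ φ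
  ren-id = mapFm-id parsT (renT ρ) renT-id

  renL-id : ∀ Γ → (∀ {χ} → χ ∈ Γ → Fixes ρ (parsF χ)) → renL ρ Γ ≡ Γ
  renL-id []      fix = refl
  renL-id (χ ∷ Γ) fix = cong₂ _∷_ (ren-id χ (fix (here refl))) (renL-id Γ (fix ∘ there))

  renB-id : ∀ B → (∀ {χ} → χ ∈B B → Fixes ρ (parsF χ)) → renB ρ B ≡ B
  renB-id (bs Γ Δ Π Σ) fix
    rewrite renL-id Γ (fix ∘ inj₁) | renL-id Δ (fix ∘ inj₂ ∘ inj₁)
          | renL-id Π (fix ∘ inj₂ ∘ inj₂ ∘ inj₁) | renL-id Σ (fix ∘ inj₂ ∘ inj₂ ∘ inj₂) = refl

transpose : ℕ → ℕ → ℕ → ℕ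
transpose a a′ b with b ≟ a | b ≟ a′
... | yes _ | _     = a′
... | no  _ | yes _ = a
... | no  _ | no  _ = b

transpose-left : ∀ a a′ → transpose a a′ a ≡ a′
transpose-left a a′ with a ≟ a | a ≟ a′
... | yes _   | yes _ = refl
... | yes _   | no  _ = refl
... | no  a≢a | _     = ⊥-elim (a≢a refl)

transpose-right : ∀ a a′ → transpose a a′ a′ ≡ a
transpose-right a a′ with a′ ≟ a | a′ ≟ a′
... | yes a′≡a | yes _    = a′≡a
... | no  _    | yes _    = refl
... | _        | no a′≢a′ = ⊥-elim (a′≢a′ refl)

transpose-other : ∀ {a a′ b} → b ≢ a → b ≢ a′ → transpose a a′ b ≡ b
transpose-other {a} {a′} {b} b≢a b≢a′ with b ≟ a | b ≟ a′
... | yes b≡a | _        = ⊥-elim (b≢a b≡a)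
... | no  _   | yes b≡a′ = ⊥-elim (b≢a′ b≡a′)
... | no  _   | no  _    = refl

transpose-involutive : ∀ a a′ b → transpose a a′ (transpose a a′ b) ≡ b
transpose-involutive a a′ b with b ≟ a | b ≟ a′
... | yes refl | _        = transpose-right a a′
... | no  _    | yes refl = transpose-left a a′
... | no  b≢a  | no  b≢a′ = transpose-other b≢a b≢a′

transpose-injective : ∀ a a′ → Injective _≡_ _≡_ (transpose a a′)
transpose-injective a a′ {b} {c} eq =
  trans (sym (transpose-involutive a a′ b)) (trans (cong (transpose a a′) eq) (transpose-involutive a a′ c))

transpose-fixes : Fresh a B → Fresh a′ B → χ ∈B B → Fixes (transpose a a′) (parsF χ)
transpose-fixes a∉B a′∉B χ∈B b∈χ =
  transpose-other (λ { refl → Fresh⇒∉parsF a∉B χ∈B b∈χ }) (λ { refl → Fresh⇒∉parsF a′∉B χ∈B b∈χ })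

module _ (ρ : ℕ → ℕ) where

  Atomic-ren : ∀ {A} → Atomic A → Atomic (ren ρ A)
  Atomic-ren at-pr = at-pr
  Atomic-ren at-E  = at-E
  Atomic-ren at-eq = at-eq

  AtomId-ren : ∀ {A} → AtomId A → AtomId (ren ρ A)
  AtomId-ren ai-pr = ai-pr
  AtomId-ren ai-eq = ai-eq

  ParDesc-renT⁻ : ∀ t s → ParDesc (renT ρ t) (renT ρ s) → ParDesc t s
  ParDesc-renT⁻ (st (par a)) (ι x φ)      _       = pd isDesc
  ParDesc-renT⁻ (ι x φ)      (st (par a)) _       = dp isDesc
  ParDesc-renT⁻ (st (par a)) (st (par b)) (pd ())
  ParDesc-renT⁻ (st (par a)) (st (par b)) (dp ())
  ParDesc-renT⁻ (st (par a)) (st (var b)) (pd ())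
  ParDesc-renT⁻ (st (var a)) (st (par b)) (dp ())

  ExAtom-ren : ∀ {A} → ExAtom A → ExAtom (ren ρ A)
  ExAtom-ren ex-pr               = ex-pr
  ExAtom-ren (ex-eq {t} {s} ¬pd) = ex-eq (¬pd ∘ ParDesc-renT⁻ t s)

  IsDesc-renT : ∀ {d} → IsDesc d → IsDesc (renT ρ d)
  IsDesc-renT isDesc = isDesc

  args-ren : ∀ A → args (ren ρ A) ≡ map (renT ρ) (args A)
  args-ren (pr p ts) = refl
  args-ren (E t)     = refl
  args-ren (t ≐ s)   = refl
  args-ren (¬' _)    = refl
  args-ren (_ ⇒' _)  = refl
  args-ren (_ ∧' _)  = refl
  args-ren (∀' _ _)  = refl

  ∈-args-ren : ∀ {t} A → t ∈ args A → renT ρ t ∈ args (ren ρ A)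
  ∈-args-ren A t∈A rewrite args-ren A = ∈-map⁺ (renT ρ) t∈A

  HasE-ren : ∀ A → HasE Γ (args A) → HasE (renL ρ Γ) (args (ren ρ A))
  HasE-ren A Es rewrite args-ren A = All.map⁺ (All.map (∈-map⁺ (ren ρ)) Es)

  ≈B-renB : B ≈B C → renB ρ B ≈B renB ρ C
  ≈B-renB {bs _ _ _ _} {bs _ _ _ _} (p , q , r , s) =
    map⁺ (ren ρ) p , map⁺ (ren ρ) q , map⁺ (ren ρ) r , map⁺ (ren ρ) s

  ren-Rule : Injective _≡_ _≡_ ρ → Rule L ps B → Rule L (map (renB ρ) ps) (renB ρ B)
  ren-Rule inj (ax-ΓΣ at)   = ax-ΓΣ (Atomic-ren at)
  ren-Rule inj (ax-ΓΔ at)   = ax-ΓΔ (Atomic-ren at)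
  ren-Rule inj (ax-ΠΣ at)   = ax-ΠΣ (Atomic-ren at)
  ren-Rule inj (ax-E {A = A} at Es) = ax-E (AtomId-ren at) (HasE-ren A Es)
  ren-Rule inj ¬-ll  = ¬-ll
  ren-Rule inj ¬-lr  = ¬-lr
  ren-Rule inj ¬-rl  = ¬-rl
  ren-Rule inj ¬-rr  = ¬-rr
  ren-Rule inj ∧-ll  = ∧-ll
  ren-Rule inj ∧-lr  = ∧-lr
  ren-Rule inj ⇒-rr  = ⇒-rr
  ren-Rule inj ⇒-rl  = ⇒-rl
  ren-Rule inj ∧-rl  = ∧-rl
  ren-Rule inj ∧-rr  = ∧-rr
  ren-Rule inj ⇒-lr  = ⇒-lr
  ren-Rule inj ⇒-ll  = ⇒-ll
  ren-Rule inj ∧-rlʷ = ∧-rlʷ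
  ren-Rule inj ∧-rrʷ = ∧-rrʷ
  ren-Rule inj ⇒-lrʷ = ⇒-lrʷ
  ren-Rule inj ⇒-llʷ = ⇒-llʷ
  ren-Rule inj (∀-lr {x = x} {φ} {a} {Γ} {Δ} {Π} {Σ} a∉)
    rewrite ren-[≔] ρ φ x (P a) = ∀-lr (Fresh-renB ρ inj (bs Γ (∀' x φ ∷ Δ) Π Σ) a∉)
  ren-Rule inj (∀-rr {x = x} {φ} {a} {Γ} {Δ} {Π} {Σ} a∉)
    rewrite ren-[≔] ρ φ x (P a) = ∀-rr (Fresh-renB ρ inj (bs Γ Δ Π (∀' x φ ∷ Σ)) a∉)
  ren-Rule inj (∀-ll {x = x} {φ} {b}) rewrite ren-[≔] ρ φ x (P b) = ∀-ll
  ren-Rule inj (∀-rl {x = x} {φ} {b}) rewrite ren-[≔] ρ φ x (P b) = ∀-rl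
  ren-Rule inj (E-ll {A = A} ex t∈) = E-ll (ExAtom-ren ex) (∈-args-ren A t∈)
  ren-Rule inj (E-rr {A = A} ex t∈) = E-rr (ExAtom-ren ex) (∈-args-ren A t∈)
  ren-Rule inj (E-rl {A = A} ex Es) = E-rl (ExAtom-ren ex) (HasE-ren A Es)
  ren-Rule inj (E-lr {A = A} ex Es) = E-lr (ExAtom-ren ex) (HasE-ren A Es)
  ren-Rule inj EE-rl = EE-rl
  ren-Rule inj EE-lr = EE-lr
  ren-Rule inj (≐-sub {A = A} {x} {t} {s} sw at ct cs cAt cAs)
    with ren-[≔] ρ A x t | ren-[≔] ρ A x s
       | Closed-ren ρ (A [ x ≔ t ]) cAt | Closed-ren ρ (A [ x ≔ s ]) cAs
  ... | eqt | eqs | cAt′ | cAs′ rewrite eqt | eqs with sw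
  ...   | true  = ≐-sub true  (Atomic-ren at) (ClosedT-renT ρ t ct) (ClosedT-renT ρ s cs) cAt′ cAs′
  ...   | false = ≐-sub false (Atomic-ren at) (ClosedT-renT ρ t ct) (ClosedT-renT ρ s cs) cAt′ cAs′
  ren-Rule inj ≐-refl = ≐-refl
  ren-Rule inj (≐-desc {d = d} {Γ} {Δ} {Π} {Σ} isd a∉) =
    ≐-desc (IsDesc-renT isd) (Fresh-renB ρ inj (bs (E d ∷ Γ) Δ Π Σ) a∉)
  ren-Rule inj (ι-ll {x = x} {φ} {c}) rewrite ren-embF[≔₀] ρ φ x c = ι-ll
  ren-Rule inj (ι-rl {x = x} {φ} {c}) rewrite ren-embF[≔₀] ρ φ x c = ι-rl
  ren-Rule inj (ι-ll₂ {x = x} {φ} {b}) rewrite ren-embF[≔₀] ρ φ x b = ι-ll₂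
  ren-Rule inj (ι-rl₂ {x = x} {φ} {b}) rewrite ren-embF[≔₀] ρ φ x b = ι-rl₂
  ren-Rule inj (ι-rr {x = x} {φ} {a} {c} {Γ} {Δ} {Π} {Σ} a∉)
    rewrite ren-embF[≔₀] ρ φ x c | ren-embF[≔₀] ρ φ x a =
    ι-rr (Fresh-renB ρ inj (bs (E (P c) ∷ Γ) Δ Π (P c ≐ ι x φ ∷ Σ)) a∉)
  ren-Rule inj (ι-lr {x = x} {φ} {a} {c} {Γ} {Δ} {Π} {Σ} a∉)
    rewrite ren-embF[≔₀] ρ φ x c | ren-embF[≔₀] ρ φ x a =
    ι-lr (Fresh-renB ρ inj (bs (E (P c) ∷ Γ) (P c ≐ ι x φ ∷ Δ) Π Σ) a∉)

ren-Derivable≤ : ∀ ρ → Injective _≡_ _≡_ ρ → Derivable≤ L n B → Derivable≤ L n (renB ρ B)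
ren-Derivable≤ {n = zero}  ρ inj d = ⊥-elim (¬Derivable≤-zero d)
ren-Derivable≤ {n = suc n} ρ inj d with lastRule r c≈B ds ← inversion d =
  byRule (ren-Rule ρ inj r) (≈B-renB ρ c≈B) (All.map⁺ (All.map (ren-Derivable≤ ρ inj) ds))

-- A rule instance splits into active formulas (T in the conclusion, ts in the premisses) and a
-- context K shared by conclusion and premisses. Replacing K by K′ gives another instance of the
-- same rule: for rules without eigenvariable as soon as ant₁ K′ contains ant₁ K (the existence
-- side conditions only look there), for the others as soon as the eigenvariable is fresh, ts
-- giving the active premisses as a function of the eigenvariable.

Equivariant : BiSeq → (ℕ → List BiSeq) → ℕ → Set
Equivariant T ts a =
  ∀ σ → (∀ {χ} → χ ∈B T → Fixes σ (parsF χ)) → map (renB σ) (ts a) ≡ ts (σ a)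

data Shape (L : Logic) (T K : BiSeq) : List BiSeq → Set where
  context-free  : ∀ {ts} → (∀ {K′} → ant₁ K ⊆ ant₁ K′ → Rule L (map (_⊕ K′) ts) (T ⊕ K′)) →
                  Shape L T K ts
  eigenvariable : ∀ {a} ts → Fresh a (T ⊕ K) →
                  (∀ {a′ K′} → Fresh a′ (T ⊕ K′) → Rule L (map (_⊕ K′) (ts a′)) (T ⊕ K′)) →
                  Equivariant T ts a → Shape L T K (ts a)

record Decomposition (L : Logic) (ps : List BiSeq) (C : BiSeq) : Set where
  constructor decomposition
  field
    {active context} : BiSeq
    {activePremisses} : List BiSeq
    shape       : Shape L active context activePremisses
    conclusion≡ : active ⊕ context ≡ C
    premisses≡  : map (_⊕ context) activePremisses ≡ ps

open Decomposition

contextFree : ∀ T {K} ts → (∀ {K′} → ant₁ K ⊆ ant₁ K′ → Rule L (map (_⊕ K′) ts) (T ⊕ K′)) →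
              Decomposition L (map (_⊕ K) ts) (T ⊕ K)
contextFree T ts r = decomposition (context-free r) refl refl

withEigenvariable : ∀ T {K} ts a → Fresh a (T ⊕ K) →
                    (∀ {a′ K′} → Fresh a′ (T ⊕ K′) → Rule L (map (_⊕ K′) (ts a′)) (T ⊕ K′)) →
                    Equivariant T ts a → Decomposition L (map (_⊕ K) (ts a)) (T ⊕ K)
withEigenvariable T ts a a∉ r equiv = decomposition (eigenvariable ts a∉ r equiv) refl refl

decompose : Rule L ps C → Decomposition L ps C
decompose (ax-ΓΣ {A = A} at) = contextFree (bs (A ∷ []) [] [] (A ∷ [])) [] λ _ → ax-ΓΣ at
decompose (ax-ΓΔ {A = A} at) = contextFree (bs (A ∷ []) (A ∷ []) [] []) [] λ _ → ax-ΓΔ at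
decompose (ax-ΠΣ {A = A} at) = contextFree (bs [] [] (A ∷ []) (A ∷ [])) [] λ _ → ax-ΠΣ at
decompose (ax-E {A = A} at Es) =
  contextFree (bs [] (A ∷ []) (A ∷ []) []) [] λ Γ⊆ → ax-E at (All.map Γ⊆ Es)
decompose (¬-ll {φ = φ}) = contextFree (bs (¬' φ ∷ []) [] [] []) (bs [] [] [] (φ ∷ []) ∷ []) λ _ → ¬-ll
decompose (¬-lr {φ = φ}) = contextFree (bs [] (¬' φ ∷ []) [] []) (bs [] [] (φ ∷ []) [] ∷ []) λ _ → ¬-lr
decompose (¬-rl {φ = φ}) = contextFree (bs [] [] (¬' φ ∷ []) []) (bs [] (φ ∷ []) [] [] ∷ []) λ _ → ¬-rl
decompose (¬-rr {φ = φ}) = contextFree (bs [] [] [] (¬' φ ∷ [])) (bs (φ ∷ []) [] [] [] ∷ []) λ _ → ¬-rr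
decompose (∧-ll {φ = φ} {ψ}) =
  contextFree (bs (φ ∧' ψ ∷ []) [] [] []) (bs (φ ∷ ψ ∷ []) [] [] [] ∷ []) λ _ → ∧-ll
decompose (∧-lr {φ = φ} {ψ}) =
  contextFree (bs [] (φ ∧' ψ ∷ []) [] []) (bs [] (φ ∷ []) [] [] ∷ bs [] (ψ ∷ []) [] [] ∷ []) λ _ → ∧-lr
decompose (⇒-rr {φ = φ} {ψ}) =
  contextFree (bs [] [] [] (φ ⇒' ψ ∷ [])) (bs (φ ∷ []) [] [] (ψ ∷ []) ∷ []) λ _ → ⇒-rr
decompose (⇒-rl {φ = φ} {ψ}) =
  contextFree (bs [] [] (φ ⇒' ψ ∷ []) []) (bs [] (φ ∷ []) [] [] ∷ bs [] [] (ψ ∷ []) [] ∷ []) λ _ → ⇒-rl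
decompose (∧-rl {φ = φ} {ψ}) =
  contextFree (bs [] [] (φ ∧' ψ ∷ []) []) (bs [] [] (φ ∷ ψ ∷ []) [] ∷ []) λ _ → ∧-rl
decompose (∧-rr {φ = φ} {ψ}) =
  contextFree (bs [] [] [] (φ ∧' ψ ∷ [])) (bs [] [] [] (φ ∷ []) ∷ bs [] [] [] (ψ ∷ []) ∷ []) λ _ → ∧-rr
decompose (⇒-lr {φ = φ} {ψ}) =
  contextFree (bs [] (φ ⇒' ψ ∷ []) [] []) (bs [] (ψ ∷ []) (φ ∷ []) [] ∷ []) λ _ → ⇒-lr
decompose (⇒-ll {φ = φ} {ψ}) =
  contextFree (bs (φ ⇒' ψ ∷ []) [] [] []) (bs [] [] [] (φ ∷ []) ∷ bs (ψ ∷ []) [] [] [] ∷ []) λ _ → ⇒-ll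
decompose (∧-rlʷ {φ = φ} {ψ}) =
  contextFree (bs [] [] (φ ∧' ψ ∷ []) [])
    (bs [] [] (φ ∷ ψ ∷ []) [] ∷ bs [] (φ ∷ []) (φ ∷ []) [] ∷ bs [] (ψ ∷ []) (ψ ∷ []) [] ∷ []) λ _ → ∧-rlʷ
decompose (∧-rrʷ {φ = φ} {ψ}) =
  contextFree (bs [] [] [] (φ ∧' ψ ∷ []))
    (bs [] [] [] (φ ∷ ψ ∷ []) ∷ bs (φ ∷ []) [] [] (ψ ∷ []) ∷ bs (ψ ∷ []) [] [] (φ ∷ []) ∷ []) λ _ → ∧-rrʷ
decompose (⇒-lrʷ {φ = φ} {ψ}) =
  contextFree (bs [] (φ ⇒' ψ ∷ []) [] [])
    (bs [] (ψ ∷ []) (φ ∷ []) [] ∷ bs [] (φ ∷ []) (φ ∷ []) [] ∷ bs [] (ψ ∷ []) (ψ ∷ []) [] ∷ []) λ _ → ⇒-lrʷ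
decompose (⇒-llʷ {φ = φ} {ψ}) =
  contextFree (bs (φ ⇒' ψ ∷ []) [] [] [])
    (bs (φ ∷ ψ ∷ []) [] [] [] ∷ bs [] [] [] (φ ∷ ψ ∷ []) ∷ bs (ψ ∷ []) [] [] (φ ∷ []) ∷ []) λ _ → ⇒-llʷ
decompose (∀-lr {x = x} {φ} {a} a∉) = withEigenvariable T ts a a∉ ∀-lr equivariant
  where
  T : BiSeq
  T = bs [] (∀' x φ ∷ []) [] []
  ts : ℕ → List BiSeq
  ts b = bs (E (P b) ∷ []) (φ [ x ≔ P b ] ∷ []) [] [] ∷ []
  equivariant : Equivariant T ts a
  equivariant σ fix rewrite ren-[≔] σ φ x (P a) | ren-id φ (fix (inj₂ (inj₁ (here refl)))) = refl
decompose (∀-rr {x = x} {φ} {a} a∉) = withEigenvariable T ts a a∉ ∀-rr equivariant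
  where
  T : BiSeq
  T = bs [] [] [] (∀' x φ ∷ [])
  ts : ℕ → List BiSeq
  ts b = bs (E (P b) ∷ []) [] [] (φ [ x ≔ P b ] ∷ []) ∷ []
  equivariant : Equivariant T ts a
  equivariant σ fix rewrite ren-[≔] σ φ x (P a) | ren-id φ (fix (inj₂ (inj₂ (inj₂ (here refl))))) = refl
decompose (∀-ll {x = x} {φ} {b}) =
  contextFree (bs (E (P b) ∷ ∀' x φ ∷ []) [] [] []) (bs (E (P b) ∷ ∀' x φ ∷ φ [ x ≔ P b ] ∷ []) [] [] [] ∷ [])
    λ _ → ∀-ll
decompose (∀-rl {x = x} {φ} {b}) =
  contextFree (bs (E (P b) ∷ []) [] (∀' x φ ∷ []) []) (bs (E (P b) ∷ []) [] (∀' x φ ∷ φ [ x ≔ P b ] ∷ []) [] ∷ [])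
    λ _ → ∀-rl
decompose (E-ll {A = A} {t} ex t∈) =
  contextFree (bs (A ∷ []) [] [] []) (bs (E t ∷ A ∷ []) [] [] [] ∷ []) λ _ → E-ll ex t∈
decompose (E-rr {A = A} {t} ex t∈) =
  contextFree (bs [] [] [] (A ∷ [])) (bs (E t ∷ []) [] [] (A ∷ []) ∷ []) λ _ → E-rr ex t∈
decompose (E-rl {A = A} ex Es) =
  contextFree (bs [] [] (A ∷ []) []) (bs (A ∷ []) [] [] [] ∷ []) λ Γ⊆ → E-rl ex (All.map Γ⊆ Es)
decompose (E-lr {A = A} ex Es) =
  contextFree (bs [] (A ∷ []) [] []) (bs [] [] [] (A ∷ []) ∷ []) λ Γ⊆ → E-lr ex (All.map Γ⊆ Es)
decompose (EE-rl {t = t}) = contextFree (bs [] [] (E t ∷ []) []) (bs (E t ∷ []) [] [] [] ∷ []) λ _ → EE-rl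
decompose (EE-lr {t = t}) = contextFree (bs [] (E t ∷ []) [] []) (bs [] [] [] (E t ∷ []) ∷ []) λ _ → EE-lr
decompose (≐-sub {A = A} {x} {t} {s} sw at ct cs cAt cAs) =
  contextFree (bs [] [] [] [])
    (bs [] [] [] ((if sw then s ≐ t else t ≐ s) ∷ []) ∷ bs [] [] [] (A [ x ≔ t ] ∷ []) ∷
     bs (A [ x ≔ s ] ∷ []) [] [] [] ∷ [])
    λ _ → ≐-sub sw at ct cs cAt cAs
decompose (≐-refl {t = t}) =
  contextFree (bs (E t ∷ []) [] [] []) (bs (t ≐ t ∷ E t ∷ []) [] [] [] ∷ []) λ _ → ≐-refl
decompose (≐-desc {a = a} {d} isd a∉) = withEigenvariable T ts a a∉ (≐-desc isd) equivariant
  where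
  T : BiSeq
  T = bs (E d ∷ []) [] [] []
  ts : ℕ → List BiSeq
  ts b = bs (P b ≐ d ∷ E d ∷ []) [] [] [] ∷ []
  equivariant : Equivariant T ts a
  equivariant σ fix rewrite renT-id d (fix (inj₁ (here refl))) = refl
decompose (ι-ll {x = x} {φ} {c}) =
  contextFree (bs (P c ≐ ι x φ ∷ E (P c) ∷ []) [] [] [])
    (bs (embF (φ [ x ≔₀ par c ]) ∷ P c ≐ ι x φ ∷ E (P c) ∷ []) [] [] [] ∷ []) λ _ → ι-ll
decompose (ι-rl {x = x} {φ} {c}) =
  contextFree (bs (E (P c) ∷ []) [] (P c ≐ ι x φ ∷ []) [])
    (bs (E (P c) ∷ []) [] (embF (φ [ x ≔₀ par c ]) ∷ P c ≐ ι x φ ∷ []) [] ∷ []) λ _ → ι-rl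
decompose (ι-ll₂ {x = x} {φ} {b} {c}) =
  contextFree (bs (P c ≐ ι x φ ∷ E (P b) ∷ E (P c) ∷ []) [] [] [])
    (bs (P c ≐ ι x φ ∷ E (P b) ∷ E (P c) ∷ []) [] [] (embF (φ [ x ≔₀ par b ]) ∷ []) ∷
     bs (P b ≐ P c ∷ P c ≐ ι x φ ∷ E (P b) ∷ E (P c) ∷ []) [] [] [] ∷ []) λ _ → ι-ll₂
decompose (ι-rl₂ {x = x} {φ} {b} {c}) =
  contextFree (bs (E (P b) ∷ E (P c) ∷ []) [] (P c ≐ ι x φ ∷ []) [])
    (bs (E (P b) ∷ E (P c) ∷ []) (embF (φ [ x ≔₀ par b ]) ∷ []) (P c ≐ ι x φ ∷ []) [] ∷
     bs (E (P b) ∷ E (P c) ∷ []) [] (P b ≐ P c ∷ P c ≐ ι x φ ∷ []) [] ∷ []) λ _ → ι-rl₂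
decompose (ι-rr {x = x} {φ} {a} {c} a∉) = withEigenvariable T ts a a∉ ι-rr equivariant
  where
  T : BiSeq
  T = bs (E (P c) ∷ []) [] [] (P c ≐ ι x φ ∷ [])
  ts : ℕ → List BiSeq
  ts b = bs (E (P c) ∷ []) [] [] (embF (φ [ x ≔₀ par c ]) ∷ []) ∷
         bs (E (P b) ∷ E (P c) ∷ embF (φ [ x ≔₀ par b ]) ∷ []) [] [] (P b ≐ P c ∷ []) ∷ []
  equivariant : Equivariant T ts a
  equivariant σ fix
    rewrite ren-embF[≔₀] σ φ x c | ren-embF[≔₀] σ φ x a
          | ren₀-id φ (fix (inj₂ (inj₂ (inj₂ (here refl)))) ∘ there)
          | fix (inj₁ (here refl)) (here refl) = refl
decompose (ι-lr {x = x} {φ} {a} {c} a∉) = withEigenvariable T ts a a∉ ι-lr equivariant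
  where
  T : BiSeq
  T = bs (E (P c) ∷ []) (P c ≐ ι x φ ∷ []) [] []
  ts : ℕ → List BiSeq
  ts b = bs (E (P c) ∷ []) (embF (φ [ x ≔₀ par c ]) ∷ []) [] [] ∷
         bs (E (P b) ∷ E (P c) ∷ []) (P b ≐ P c ∷ []) (embF (φ [ x ≔₀ par b ]) ∷ []) [] ∷ []
  equivariant : Equivariant T ts a
  equivariant σ fix
    rewrite ren-embF[≔₀] σ φ x c | ren-embF[≔₀] σ φ x a
          | ren₀-id φ (fix (inj₂ (inj₁ (here refl))) ∘ there)
          | fix (inj₁ (here refl)) (here refl) = refl

transpose-premisses : ∀ {T K ts a a′} → Fresh a (T ⊕ K) → Fresh a′ (T ⊕ K) → Equivariant T ts a →
                      map (renB (transpose a a′)) (map (_⊕ K) (ts a)) ≡ map (_⊕ K) (ts a′)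
transpose-premisses {T} {K} {ts} {a} {a′} a∉ a′∉ equivariant = begin
  map (renB σ) (map (_⊕ K) (ts a))  ≡⟨ map-∘ (ts a) ⟨
  map (renB σ ∘ (_⊕ K)) (ts a)      ≡⟨ map-cong renB-⊕K (ts a) ⟩
  map ((_⊕ K) ∘ renB σ) (ts a)      ≡⟨ map-∘ (ts a) ⟩
  map (_⊕ K) (map (renB σ) (ts a))  ≡⟨ cong (map (_⊕ K)) (equivariant σ (fixes ∘ ⊆B-⊕ʳ T K)) ⟩
  map (_⊕ K) (ts (σ a))             ≡⟨ cong (map (_⊕ K) ∘ ts) (transpose-left a a′) ⟩
  map (_⊕ K) (ts a′)                ∎
  where
  open ≡-Reasoning
  σ : ℕ → ℕ
  σ = transpose a a′
  fixes : χ ∈B T ⊕ K → Fixes σ (parsF χ)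
  fixes = transpose-fixes a∉ a′∉
  renB-⊕K : ∀ B → renB σ (B ⊕ K) ≡ renB σ B ⊕ K
  renB-⊕K B = trans (renB-⊕ σ B K) (cong (renB σ B ⊕_) (renB-id K (fixes ∘ ⊆B-⊕ˡ T K)))

weaken : ∀ D → Derivable≤ L n B → Derivable≤ L n (B ⊕ D)
weaken {n = zero}  D d = ⊥-elim (¬Derivable≤-zero d)
weaken {L} {suc n} D d with lastRule r c≈B ds ← inversion d | decompose r
... | decomposition {T} {K} shape refl refl =
  Derivable≤-resp-≈B (≈B-trans (⊕-assoc T K D) (⊕-respˡ-≈B D c≈B)) (weakened shape ds)
  where
  weaken-premisses : ∀ {ts} → All (Derivable≤ L n) (map (_⊕ K) ts) →
                     All (Derivable≤ L n) (map (_⊕ (K ⊕ D)) ts)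
  weaken-premisses =
    All.map⁺ ∘ All.map (λ {T′} → Derivable≤-resp-≈B (≈B-sym (⊕-assoc T′ K D)) ∘ weaken D) ∘ All.map⁻

  weakened : ∀ {ts} → Shape L T K ts → All (Derivable≤ L n) (map (_⊕ K) ts) →
             Derivable≤ L (suc n) (T ⊕ (K ⊕ D))
  weakened (context-free r′) ds = byRule′ (r′ ∈-++⁺ˡ) (weaken-premisses ds)
  weakened (eigenvariable {a} ts a∉ r′ equivariant) ds = byRule′ (r′ b∉) (weaken-premisses renamed)
    where
    -- a may occur in D, so the eigenvariable is first renamed to some b fresh for everything.
    b : ℕ
    b = fresh (parsB (T ⊕ (K ⊕ D)))
    b∉ : Fresh b (T ⊕ (K ⊕ D))
    b∉ = fresh-∉ _
    b∉TK : Fresh b (T ⊕ K)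
    b∉TK = Fresh-⊆B (≈B⇒⊆B (≈B-sym (⊕-assoc T K D)) ∘ ⊆B-⊕ʳ (T ⊕ K) D) b∉
    renamed : All (Derivable≤ L n) (map (_⊕ K) (ts b))
    renamed = subst (All (Derivable≤ L n)) (transpose-premisses {ts = ts} a∉ b∉TK equivariant)
                    (All.map⁺ (All.map (ren-Derivable≤ _ (transpose-injective a b)) ds))

weaken-ant₁ : ∀ χ → Derivable≤ L n (bs Γ Δ Π Σ) → Derivable≤ L n (bs (χ ∷ Γ) Δ Π Σ)
weaken-ant₁ {Γ = Γ} {Δ} {Π} {Σ} χ =
  Derivable≤-resp-≈B (↭-sym (∷↭∷ʳ χ Γ) , ++-identityʳ Δ , ++-identityʳ Π , ++-identityʳ Σ)
  ∘ weaken (bs (χ ∷ []) [] [] [])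

weaken-suc₂ : ∀ χ → Derivable≤ L n (bs Γ Δ Π Σ) → Derivable≤ L n (bs Γ Δ Π (χ ∷ Σ))
weaken-suc₂ {Γ = Γ} {Δ} {Π} {Σ} χ =
  Derivable≤-resp-≈B (++-identityʳ Γ , ++-identityʳ Δ , ++-identityʳ Π , ↭-sym (∷↭∷ʳ χ Σ))
  ∘ weaken (bs [] [] [] (χ ∷ []))

permute-ant₁ : Γ ↭ Γ′ → Derivable≤ L n (bs Γ Δ Π Σ) → Derivable≤ L n (bs Γ′ Δ Π Σ)
permute-ant₁ p = Derivable≤-resp-≈B (p , ↭-refl , ↭-refl , ↭-refl)

permute-suc₁ : Δ ↭ Δ′ → Derivable≤ L n (bs Γ Δ Π Σ) → Derivable≤ L n (bs Γ Δ′ Π Σ)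
permute-suc₁ p = Derivable≤-resp-≈B (↭-refl , p , ↭-refl , ↭-refl)

permute-ant₂ : Π ↭ Π′ → Derivable≤ L n (bs Γ Δ Π Σ) → Derivable≤ L n (bs Γ Δ Π′ Σ)
permute-ant₂ p = Derivable≤-resp-≈B (↭-refl , ↭-refl , p , ↭-refl)

permute-suc₂ : Σ ↭ Σ′ → Derivable≤ L n (bs Γ Δ Π Σ) → Derivable≤ L n (bs Γ Δ Π Σ′)
permute-suc₂ p = Derivable≤-resp-≈B (↭-refl , ↭-refl , ↭-refl , p)

≈B-ant₂ : B ≈B C → ant₂ B ↭ ant₂ C
≈B-ant₂ {bs _ _ _ _} {bs _ _ _ _} (_ , _ , p , _) = p

≈B-suc₁ : B ≈B C → suc₁ B ↭ suc₁ C
≈B-suc₁ {bs _ _ _ _} {bs _ _ _ _} (_ , q , _ , _) = q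

∈⇒↭∷ : ∀ {A : Set} {x : A} {xs} → x ∈ xs → ∃ λ ys → xs ↭ x ∷ ys
∈⇒↭∷ x∈xs with ys , zs , refl ← ∈-∃++ x∈xs = ys ++ zs , shift _ ys zs

++-↭-∷⁻ : ∀ {A : Set} {x : A} xs ys {zs} → xs ++ ys ↭ x ∷ zs →
          x ∈ xs ⊎ ∃ λ ys′ → ys ↭ x ∷ ys′ × xs ++ ys′ ↭ zs
++-↭-∷⁻ {x = x} xs ys p with ∈-++⁻ xs (∈-resp-↭ (↭-sym p) (here refl))
... | inj₁ x∈xs = inj₁ x∈xs
... | inj₂ x∈ys with ys′ , ys↭ ← ∈⇒↭∷ x∈ys =
  inj₂ (ys′ , ys↭ , drop-∷ (↭-trans (↭-sym (↭-trans (++⁺ˡ xs ys↭) (shift x xs ys′))) p))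

Transferˡ : Logic → ℕ → Set
Transferˡ L n = ∀ {φ Γ Δ Π Σ} →
  Derivable≤ L n (bs Γ Δ (φ ∷ Π) Σ) → Derivable≤ L n (bs (φ ∷ Γ) Δ Π Σ)

Transferʳ : Logic → ℕ → Set
Transferʳ L n = ∀ {φ Γ Δ Π Σ} →
  Derivable≤ L n (bs Γ (φ ∷ Δ) Π Σ) → Derivable≤ L n (bs Γ Δ Π (φ ∷ Σ))

reapply-in-context : ∀ {T K K′ ts} → Shape L T K ts → ant₁ K ⊆ ant₁ K′ →
                     (∀ {a} → Fresh a (T ⊕ K) → Fresh a (T ⊕ K′)) →
                     (∀ {T′} → Derivable≤ L n (T′ ⊕ K) → Derivable≤ L n (T′ ⊕ K′)) →
                     All (Derivable≤ L n) (map (_⊕ K) ts) → Derivable≤ L (suc n) (T ⊕ K′)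
reapply-in-context (context-free r) Γ⊆ _ move =
  byRule′ (r Γ⊆) ∘ All.map⁺ ∘ All.map move ∘ All.map⁻
reapply-in-context (eigenvariable _ a∉ r _) _ keeps-fresh move =
  byRule′ (r (keeps-fresh a∉)) ∘ All.map⁺ ∘ All.map move ∘ All.map⁻

transferˡ-context : ∀ {φ Π′} → Transferˡ L n → (dec : Decomposition L ps C) → C ≈B bs Γ Δ (φ ∷ Π) Σ →
                    ant₂ (context dec) ↭ φ ∷ Π′ → ant₂ (active dec) ++ Π′ ↭ Π →
                    All (Derivable≤ L n) ps → Derivable≤ L (suc n) (bs (φ ∷ Γ) Δ Π Σ)
transferˡ-context {L = L} {n} {Γ = Γ} {Δ} {Π} {Σ} {φ} {Π′} ltr (decomposition {T} {K} shape refl refl)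
                  C≈ K↭ TΠ′↭ ds =
  Derivable≤-resp-≈B T⊕K′≈ (reapply-in-context shape there keeps-fresh move ds)
  where
  K′ : BiSeq
  K′ = bs (φ ∷ ant₁ K) (suc₁ K) Π′ (suc₂ K)
  T⊕K′≈ : T ⊕ K′ ≈B bs (φ ∷ Γ) Δ Π Σ
  T⊕K′≈ = let g , d , _ , s = C≈ in ↭-trans (shift φ (ant₁ T) (ant₁ K)) (prep φ g) , d , TΠ′↭ , s
  keeps-fresh : ∀ {a} → Fresh a (T ⊕ K) → Fresh a (T ⊕ K′)
  keeps-fresh = Fresh-⊆B (≈B⇒⊆B (≈B-sym C≈) ∘ transferˡ-⊆B ∘ ≈B⇒⊆B T⊕K′≈)
  move : ∀ {T′} → Derivable≤ L n (T′ ⊕ K) → Derivable≤ L n (T′ ⊕ K′)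
  move {T′} = permute-ant₁ (↭-sym (shift φ (ant₁ T′) (ant₁ K))) ∘ ltr
            ∘ permute-ant₂ (↭-trans (++⁺ˡ (ant₂ T′) K↭) (shift φ (ant₂ T′) Π′))

transferʳ-context : ∀ {φ Δ′} → Transferʳ L n → (dec : Decomposition L ps C) → C ≈B bs Γ (φ ∷ Δ) Π Σ →
                    suc₁ (context dec) ↭ φ ∷ Δ′ → suc₁ (active dec) ++ Δ′ ↭ Δ →
                    All (Derivable≤ L n) ps → Derivable≤ L (suc n) (bs Γ Δ Π (φ ∷ Σ))
transferʳ-context {L = L} {n} {Γ = Γ} {Δ} {Π} {Σ} {φ} {Δ′} rtr (decomposition {T} {K} shape refl refl)
                  C≈ K↭ TΔ′↭ ds =
  Derivable≤-resp-≈B T⊕K′≈ (reapply-in-context shape (λ m → m) keeps-fresh move ds)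
  where
  K′ : BiSeq
  K′ = bs (ant₁ K) Δ′ (ant₂ K) (φ ∷ suc₂ K)
  T⊕K′≈ : T ⊕ K′ ≈B bs Γ Δ Π (φ ∷ Σ)
  T⊕K′≈ = let g , _ , p , s = C≈ in g , TΔ′↭ , p , ↭-trans (shift φ (suc₂ T) (suc₂ K)) (prep φ s)
  keeps-fresh : ∀ {a} → Fresh a (T ⊕ K) → Fresh a (T ⊕ K′)
  keeps-fresh = Fresh-⊆B (≈B⇒⊆B (≈B-sym C≈) ∘ transferʳ-⊆B ∘ ≈B⇒⊆B T⊕K′≈)
  move : ∀ {T′} → Derivable≤ L n (T′ ⊕ K) → Derivable≤ L n (T′ ⊕ K′)
  move {T′} = permute-suc₂ (↭-sym (shift φ (suc₂ T′) (suc₂ K))) ∘ rtr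
            ∘ permute-suc₁ (↭-trans (++⁺ˡ (suc₁ T′) K↭) (shift φ (suc₁ T′) Δ′))

AtomId⇒Atomic : ∀ {A} → AtomId A → Atomic A
AtomId⇒Atomic ai-pr = at-pr
AtomId⇒Atomic ai-eq = at-eq

resp-transferˡ : bs Γ Δ (χ ∷ Π) Σ ≈B bs Γ′ Δ′ (χ ∷ Π′) Σ′ →
                 Derivable≤ L n (bs (χ ∷ Γ) Δ Π Σ) → Derivable≤ L n (bs (χ ∷ Γ′) Δ′ Π′ Σ′)
resp-transferˡ {χ = χ} (g , d , p , s) = Derivable≤-resp-≈B (prep χ g , d , drop-∷ p , s)

resp-transferʳ : bs Γ (χ ∷ Δ) Π Σ ≈B bs Γ′ (χ ∷ Δ′) Π′ Σ′ →
                 Derivable≤ L n (bs Γ Δ Π (χ ∷ Σ)) → Derivable≤ L n (bs Γ′ Δ′ Π′ (χ ∷ Σ′))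
resp-transferʳ {χ = χ} (g , d , p , s) = Derivable≤-resp-≈B (g , drop-∷ d , p , prep χ s)

module _ {L : Logic} {n : ℕ} (ltr : Transferˡ L n) (rtr : Transferʳ L n) where

  transferˡ-principal : ∀ {φ} (r : Rule L ps C) → φ ∈ ant₂ (active (decompose r)) →
                        C ≈B bs Γ Δ (φ ∷ Π) Σ → All (Derivable≤ L n) ps →
                        Derivable≤ L (suc n) (bs (φ ∷ Γ) Δ Π Σ)
  transferˡ-principal (ax-ΓΣ _) ()
  transferˡ-principal (ax-ΓΔ _) ()
  transferˡ-principal (ax-ΠΣ at) (here refl) C≈ [] = resp-transferˡ C≈ (byRule′ (ax-ΓΣ at) [])
  transferˡ-principal (ax-E at _) (here refl) C≈ [] =
    resp-transferˡ C≈ (byRule′ (ax-ΓΔ (AtomId⇒Atomic at)) [])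
  transferˡ-principal ¬-ll ()
  transferˡ-principal ¬-lr ()
  transferˡ-principal ¬-rl (here refl) C≈ (d ∷ []) = resp-transferˡ C≈ (byRule′ ¬-ll (rtr d ∷ []))
  transferˡ-principal ¬-rr ()
  transferˡ-principal ∧-ll ()
  transferˡ-principal ∧-lr ()
  transferˡ-principal ⇒-rr ()
  transferˡ-principal (⇒-rl {L = K3}) (here refl) C≈ (d ∷ e ∷ []) =
    resp-transferˡ C≈ (byRule′ ⇒-ll (rtr d ∷ ltr e ∷ []))
  transferˡ-principal (⇒-rl {L = K3w} {φ} {ψ}) (here refl) C≈ (d ∷ e ∷ []) =
    resp-transferˡ C≈
      (byRule′ ⇒-llʷ (weaken-ant₁ φ (ltr e) ∷ permute-suc₂ (swap ψ φ ↭-refl) (weaken-suc₂ ψ (rtr d)) ∷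
                      weaken-ant₁ ψ (rtr d) ∷ []))
  transferˡ-principal ∧-rl (here refl) C≈ (d ∷ []) =
    resp-transferˡ C≈ (byRule′ ∧-ll (permute-ant₁ (swap _ _ ↭-refl) (ltr (ltr d)) ∷ []))
  transferˡ-principal ∧-rr ()
  transferˡ-principal ⇒-lr ()
  transferˡ-principal ⇒-ll ()
  transferˡ-principal ∧-rlʷ (here refl) C≈ (d ∷ _ ∷ _ ∷ []) =
    resp-transferˡ C≈ (byRule′ ∧-ll (permute-ant₁ (swap _ _ ↭-refl) (ltr (ltr d)) ∷ []))
  transferˡ-principal ∧-rrʷ ()
  transferˡ-principal ⇒-lrʷ ()
  transferˡ-principal ⇒-llʷ ()
  transferˡ-principal (∀-lr _) ()
  transferˡ-principal (∀-rr _) ()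
  transferˡ-principal ∀-ll ()
  transferˡ-principal ∀-rl (here refl) C≈ (d ∷ []) =
    resp-transferˡ C≈
      (permute-ant₁ (swap _ _ ↭-refl) (byRule′ ∀-ll (permute-ant₁ reverse₃ (ltr (ltr d)) ∷ [])))
    where
    reverse₃ : ∀ {A : Set} {x y z : A} {xs} → x ∷ y ∷ z ∷ xs ↭ z ∷ y ∷ x ∷ xs
    reverse₃ = ↭-trans (swap _ _ ↭-refl) (↭-trans (prep _ (swap _ _ ↭-refl)) (swap _ _ ↭-refl))
  transferˡ-principal (E-ll _ _) ()
  transferˡ-principal (E-rr _ _) ()
  transferˡ-principal (E-rl _ _) (here refl) C≈ (d ∷ []) = resp-transferˡ C≈ (Derivable≤-suc d)
  transferˡ-principal (E-lr _ _) ()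
  transferˡ-principal EE-rl (here refl) C≈ (d ∷ []) = resp-transferˡ C≈ (Derivable≤-suc d)
  transferˡ-principal EE-lr ()
  transferˡ-principal (≐-sub _ _ _ _ _ _) ()
  transferˡ-principal ≐-refl ()
  transferˡ-principal (≐-desc _ _) ()
  transferˡ-principal ι-ll ()
  transferˡ-principal ι-rl (here refl) C≈ (d ∷ []) =
    resp-transferˡ C≈ (byRule′ ι-ll (permute-ant₁ (swap _ _ ↭-refl) (ltr (ltr d)) ∷ []))
  transferˡ-principal ι-ll₂ ()
  transferˡ-principal ι-rl₂ (here refl) C≈ (d ∷ e ∷ []) =
    resp-transferˡ C≈
      (byRule′ ι-ll₂ (rtr (ltr d) ∷ permute-ant₁ (swap _ _ ↭-refl) (ltr (ltr e)) ∷ []))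
  transferˡ-principal (ι-rr _) ()
  transferˡ-principal (ι-lr _) ()

  transferʳ-principal : ∀ {φ} (r : Rule L ps C) → φ ∈ suc₁ (active (decompose r)) →
                        C ≈B bs Γ (φ ∷ Δ) Π Σ → All (Derivable≤ L n) ps →
                        Derivable≤ L (suc n) (bs Γ Δ Π (φ ∷ Σ))
  transferʳ-principal (ax-ΓΣ _) ()
  transferʳ-principal (ax-ΓΔ at) (here refl) C≈ [] = resp-transferʳ C≈ (byRule′ (ax-ΓΣ at) [])
  transferʳ-principal (ax-ΠΣ _) ()
  transferʳ-principal (ax-E at _) (here refl) C≈ [] =
    resp-transferʳ C≈ (byRule′ (ax-ΠΣ (AtomId⇒Atomic at)) [])
  transferʳ-principal ¬-ll ()
  transferʳ-principal ¬-lr (here refl) C≈ (d ∷ []) = resp-transferʳ C≈ (byRule′ ¬-rr (ltr d ∷ []))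
  transferʳ-principal ¬-rl ()
  transferʳ-principal ¬-rr ()
  transferʳ-principal ∧-ll ()
  transferʳ-principal (∧-lr {L = K3}) (here refl) C≈ (d ∷ e ∷ []) =
    resp-transferʳ C≈ (byRule′ ∧-rr (rtr d ∷ rtr e ∷ []))
  transferʳ-principal (∧-lr {L = K3w} {φ} {ψ}) (here refl) C≈ (d ∷ e ∷ []) =
    resp-transferʳ C≈
      (byRule′ ∧-rrʷ (weaken-suc₂ φ (rtr e) ∷ weaken-ant₁ φ (rtr e) ∷ weaken-ant₁ ψ (rtr d) ∷ []))
  transferʳ-principal ⇒-rr ()
  transferʳ-principal ⇒-rl ()
  transferʳ-principal ∧-rl ()
  transferʳ-principal ∧-rr ()
  transferʳ-principal ⇒-lr (here refl) C≈ (d ∷ []) = resp-transferʳ C≈ (byRule′ ⇒-rr (ltr (rtr d) ∷ []))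
  transferʳ-principal ⇒-ll ()
  transferʳ-principal ∧-rlʷ ()
  transferʳ-principal ∧-rrʷ ()
  transferʳ-principal ⇒-lrʷ (here refl) C≈ (d ∷ _ ∷ _ ∷ []) =
    resp-transferʳ C≈ (byRule′ ⇒-rr (ltr (rtr d) ∷ []))
  transferʳ-principal ⇒-llʷ ()
  transferʳ-principal (∀-lr {x = x} {φ} {a} {Γ} {Δ} {Π} {Σ} a∉) (here refl) C≈ (d ∷ []) =
    resp-transferʳ C≈ (byRule′ (∀-rr (Fresh-transferʳ {a} {∀' x φ} {Γ} {Δ} {Π} {Σ} a∉)) (rtr d ∷ []))
  transferʳ-principal (∀-rr _) ()
  transferʳ-principal ∀-ll ()
  transferʳ-principal ∀-rl ()
  transferʳ-principal (E-ll _ _) ()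
  transferʳ-principal (E-rr _ _) ()
  transferʳ-principal (E-rl _ _) ()
  transferʳ-principal (E-lr _ _) (here refl) C≈ (d ∷ []) = resp-transferʳ C≈ (Derivable≤-suc d)
  transferʳ-principal EE-rl ()
  transferʳ-principal EE-lr (here refl) C≈ (d ∷ []) = resp-transferʳ C≈ (Derivable≤-suc d)
  transferʳ-principal (≐-sub _ _ _ _ _ _) ()
  transferʳ-principal ≐-refl ()
  transferʳ-principal (≐-desc _ _) ()
  transferʳ-principal ι-ll ()
  transferʳ-principal ι-rl ()
  transferʳ-principal ι-ll₂ ()
  transferʳ-principal ι-rl₂ ()
  transferʳ-principal (ι-rr _) ()
  transferʳ-principal (ι-lr {x = x} {φ} {a} {c} {Γ} {Δ} {Π} {Σ} a∉) (here refl) C≈ (d ∷ e ∷ []) =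
    resp-transferʳ C≈
      (byRule′ (ι-rr (Fresh-transferʳ {a} {P c ≐ ι x φ} {E (P c) ∷ Γ} {Δ} {Π} {Σ} a∉))
               (rtr d ∷ permute-ant₁ rotate (ltr (rtr e)) ∷ []))
    where
    rotate : ∀ {A : Set} {x y z : A} {xs} → x ∷ y ∷ z ∷ xs ↭ y ∷ z ∷ x ∷ xs
    rotate = ↭-trans (swap _ _ ↭-refl) (prep _ (swap _ _ ↭-refl))

transfer : ∀ n → Transferˡ L n × Transferʳ L n
transfer zero          = ⊥-elim ∘ ¬Derivable≤-zero , ⊥-elim ∘ ¬Derivable≤-zero
transfer {L} (suc n) = ltr , rtr
  where
  ltr′ : Transferˡ L n
  ltr′ = proj₁ (transfer n)

  rtr′ : Transferʳ L n
  rtr′ = proj₂ (transfer n)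

  ltr : Transferˡ L (suc n)
  ltr {φ} {Π = Π} d with inversion d
  ... | lastRule r C≈ ds
    with ++-↭-∷⁻ (ant₂ (active (decompose r))) (ant₂ (context (decompose r)))
                 (subst (λ C → ant₂ C ↭ φ ∷ Π) (sym (conclusion≡ (decompose r))) (≈B-ant₂ C≈))
  ... | inj₁ φ∈T              = transferˡ-principal ltr′ rtr′ r φ∈T C≈ ds
  ... | inj₂ (Π′ , K↭ , TΠ′↭) = transferˡ-context ltr′ (decompose r) C≈ K↭ TΠ′↭ ds

  rtr : Transferʳ L (suc n)
  rtr {φ} {Δ = Δ} d with inversion d
  ... | lastRule r C≈ ds
    with ++-↭-∷⁻ (suc₁ (active (decompose r))) (suc₁ (context (decompose r)))
                 (subst (λ C → suc₁ C ↭ φ ∷ Δ) (sym (conclusion≡ (decompose r))) (≈B-suc₁ C≈))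
  ... | inj₁ φ∈T              = transferʳ-principal ltr′ rtr′ r φ∈T C≈ ds
  ... | inj₂ (Δ′ , K↭ , TΔ′↭) = transferʳ-context rtr′ (decompose r) C≈ K↭ TΔ′↭ ds

lemma8 : ∀ (L : Logic) (n : ℕ) (φ : Form) (Γ Δ Π Σ : List Form) →
    Closed φ → All Closed Γ → All Closed Δ → All Closed Π → All Closed Σ →
    (Derivable≤ L n (bs Γ Δ (φ ∷ Π) Σ) → Derivable≤ L n (bs (φ ∷ Γ) Δ Π Σ))
    × (Derivable≤ L n (bs Γ (φ ∷ Δ) Π Σ) → Derivable≤ L n (bs Γ Δ Π (φ ∷ Σ)))
-- Transfer never changes a formula.
lemma8 L n φ Γ Δ Π Σ _ _ _ _ _ = proj₁ (transfer n) , proj₂ (transfer n)
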